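{- Let $s>2$ be an integer and let $G$ be an $(s,s)$-erasable graph on $2s+1$ vertices. Then $|E(G)|\le 4s-4$.
   Context: Let $G=(V,E)$ be a graph on $s+t+1$ vertices. An edge $e\in E(G)$ is called erasable in $G$ if there is a partition $(V_1,V_2,\{v\})$ of $V$ with $|V_1|=s$, $|V_2|=t$ such that $e$ is the only edge of $G$ between $V_1$ and $V_2$. A graph $G$ with $m$ edges is $(s,t)$-erasable if there is an ordering $e_1,\dots,e_m$ of $E(G)$ such that for every $i\in[m]$, $e_i$ is erasable in $G\setminus\{e_1,\dots,e_{i-1}\}$. Here $t=s$. -}

module Defs where

open import Data.Nat using (ℕ; _+_)
open import Data.Fin using (Fin; _<_; _≟_)
open import Data.Fin.Patterns using (0F; 1F; 2F)
open import Data.List using (List; []; _∷_; length; filter; allFin)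
open import Data.List.Membership.Propositional using (_∈_)
open import Data.List.Relation.Unary.All using (All)
open import Data.List.Relation.Unary.Unique.Propositional using (Unique)
open import Data.List.Relation.Binary.Permutation.Propositional using (_↭_)
open import Data.Product using (_×_; Σ; ∃; _,_; proj₁; proj₂)
open import Data.Sum using (_⊎_)
open import Data.Unit using (⊤)
open import Relation.Binary.PropositionalEquality using (_≡_)

-- A potential edge on vertex set Fin n: an ordered pair (i , j), read as {i , j}.
Edge : ℕ → Set
Edge n = Fin n × Fin n

record Graph (n : ℕ) : Set where
  constructor mkGraph
  field
    edges     : List (Edge n)
    canonical : All (λ e → proj₁ e < proj₂ e) edges
    unique    : Unique edges
open Graph public

-- A labelling of vertices: 0F = V₁, 1F = V₂, 2F = the singleton {v}.
Labelling : ℕ → Set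
Labelling n = Fin n → Fin 3

classSize : ∀ {n} → Labelling n → Fin 3 → ℕ
classSize {n} p k = length (filter (λ x → p x ≟ k) (allFin n))

IsPartition : ∀ {n} → ℕ → ℕ → Labelling n → Set
IsPartition s t p = classSize p 0F ≡ s × classSize p 1F ≡ t × classSize p 2F ≡ 1

Crosses : ∀ {n} → Labelling n → Edge n → Set
Crosses p (i , j) = (p i ≡ 0F × p j ≡ 1F) ⊎ (p i ≡ 1F × p j ≡ 0F)

ErasableIn : ∀ {n} → ℕ → ℕ → List (Edge n) → Edge n → Set
ErasableIn {n} s t E e =
  Σ (Labelling n) λ p → IsPartition s t p × e ∈ E × Crosses p e
    × All (λ f → Crosses p f → f ≡ e) E

-- ordering e₁ ∷ e₂ ∷ … where each eᵢ is erasable in the graph with edges eᵢ, eᵢ₊₁, …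
-- (i.e. G with e₁,…,eᵢ₋₁ deleted)
ErasingOrder : ∀ {n} → ℕ → ℕ → List (Edge n) → Set
ErasingOrder s t [] = ⊤
ErasingOrder s t (e ∷ es) = ErasableIn s t (e ∷ es) e × ErasingOrder s t es

IsErasable : (s t : ℕ) → Graph (s + t + 1) → Set
IsErasable s t G = Σ (List (Edge (s + t + 1))) λ L → (L ↭ edges G) × ErasingOrder s t L

numEdges : ∀ {n} → Graph n → ℕ
numEdges G = length (edges G)

{-# OPTIONS --safe #-}

-- Write laman k = max 0 (2k − 3).  If the edges of an erasing order are covered by vertex sets
-- X₁, …, Xᵣ (every edge lies inside some Xᵢ), there are at most Σ laman ∣Xᵢ∣ of them: the first
-- edge e is the only edge across its separator (V₁, V₂, {w}), so the remaining edges are covered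
-- by the closed sides Xᵢ ∩ (V₁ ∪ {w}) and Xᵢ ∩ (V₂ ∪ {w}), whose capacities add up to at most
-- that of Xᵢ, and to strictly less for a set containing e.  After the first erasure the edges
-- lie in the two closed sides P, Q of its separator, of capacity 2 (2s − 1), which meet exactly
-- in its centre v; this only gives 4s − 1.  The missing 3 come from the second separator.  If
-- its centre is v, it lowers the capacity of P and Q by 2, and their four pieces form a
-- "sunflower" of sets of size at most s around v, which always carries 2 edges less than its
-- capacity.  Otherwise the pieces either lose 4 in capacity at once or, after discarding
-- singletons, form a cover by two disjoint s-sets (and possibly a pair), or by an s-set and an
-- (s + 1)-set, which carries 1, respectively 2, edges less than its capacity.
module Submission where

open import Defs
open import Data.Nat using (ℕ; _≤_; _<_; _+_; _*_; _∸_)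

open import Data.Nat using (zero; suc; z≤n; s≤s; _⊓_)
open import Data.Nat.Properties hiding (_≟_)
open import Data.Nat.Tactic.RingSolver using (solve-∀)
open import Algebra.Properties.CommutativeSemigroup +-commutativeSemigroup using (interchange)
open import Algebra.Properties.CommutativeMonoid.Sum +-0-commutativeMonoid
  using (sum; sum-syntax; ∑-distrib-+; sum-cong-≗; sum-replicate-zero)
open import Data.Bool using (Bool; true; false; _∧_; not; if_then_else_)
open import Data.Bool.Properties using (∧-identityʳ; ∧-zeroʳ; ¬-not)
import Data.Bool.Properties as Bool
open import Data.Fin using (Fin; zero; suc; _≟_)
open import Data.Fin.Patterns using (0F; 1F; 2F)
open import Data.Fin.Properties using (any?)
open import Data.List using (List; []; _∷_; _++_; length; filter; tabulate)
open import Data.List.Relation.Unary.All as All using (All; []; _∷_)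
open import Data.List.Relation.Unary.Any using (Any; here; there)
open import Data.List.Relation.Unary.Any.Properties using (++⁺ˡ; ++⁺ʳ; ++⁻)
open import Data.List.Relation.Unary.Unique.Propositional using (Unique; []; _∷_)
open import Data.List.Relation.Binary.Permutation.Propositional using (↭-sym; ↭⇒↭ₛ)
open import Data.List.Relation.Binary.Permutation.Propositional.Properties using (↭-length)
import Data.List.Relation.Binary.Permutation.Setoid.Properties as Permutation
open import Data.Product using (∃; _×_; _,_; proj₁; proj₂; uncurry)
open import Data.Sum using (_⊎_; inj₁; inj₂)
open import Data.Empty using (⊥; ⊥-elim)
open import Function using (_∘_)
open import Relation.Binary.PropositionalEquality
open import Relation.Nullary using (¬_; Dec; does; yes; no; contradiction)
open import Relation.Nullary.Decidable using (dec-true; dec-false)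

open ≤-Reasoning

variable
  A : Set
  n : ℕ

⟦_⟧ : Bool → ℕ
⟦ true ⟧  = 1
⟦ false ⟧ = 0

∑ₗ : List A → (A → ℕ) → ℕ
∑ₗ []       f = 0
∑ₗ (a ∷ as) f = f a + ∑ₗ as f

infixl 10 ∑ₗ
syntax ∑ₗ as (λ a → e) = ∑[ a ∈ as ] e

∑-mono-≤ : {f g : Fin n → ℕ} → (∀ i → f i ≤ g i) → sum f ≤ sum g
∑-mono-≤ {zero}  _   = z≤n
∑-mono-≤ {suc n} f≤g = +-mono-≤ (f≤g zero) (∑-mono-≤ (f≤g ∘ suc))

∑ₗ-cong : ∀ (as : List A) {f g : A → ℕ} → (∀ a → f a ≡ g a) → ∑ₗ as f ≡ ∑ₗ as g
∑ₗ-cong []       _   = refl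
∑ₗ-cong (a ∷ as) f≗g = cong₂ _+_ (f≗g a) (∑ₗ-cong as f≗g)

∑ₗ-mono-≤ : ∀ {as : List A} {f g : A → ℕ} → All (λ a → f a ≤ g a) as → ∑ₗ as f ≤ ∑ₗ as g
∑ₗ-mono-≤ []           = z≤n
∑ₗ-mono-≤ (fa≤ga ∷ le) = +-mono-≤ fa≤ga (∑ₗ-mono-≤ le)

∑ₗ-zero : ∀ (as : List A) → ∑[ a ∈ as ] 0 ≡ 0
∑ₗ-zero []       = refl
∑ₗ-zero (_ ∷ as) = ∑ₗ-zero as

∑ₗ-distrib-+ : ∀ (as : List A) (f g : A → ℕ) → ∑[ a ∈ as ] (f a + g a) ≡ ∑ₗ as f + ∑ₗ as g
∑ₗ-distrib-+ []       f g = refl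
∑ₗ-distrib-+ (a ∷ as) f g =
  trans (cong (f a + g a +_) (∑ₗ-distrib-+ as f g)) (interchange (f a) (g a) _ _)

∑ₗ-* : ∀ (as : List A) k (f : A → ℕ) → ∑[ a ∈ as ] (k * f a) ≡ k * ∑ₗ as f
∑ₗ-* []       k f = sym (*-zeroʳ k)
∑ₗ-* (a ∷ as) k f = trans (cong (k * f a +_) (∑ₗ-* as k f)) (sym (*-distribˡ-+ k (f a) _))

∑ₗ-∑-comm : ∀ (as : List A) (f : A → Fin n → ℕ) →
  ∑[ a ∈ as ] ∑[ i < n ] f a i ≡ ∑[ i < n ] ∑[ a ∈ as ] f a i
∑ₗ-∑-comm {n = n} []       f = sym (sum-replicate-zero n)
∑ₗ-∑-comm         (a ∷ as) f =
  trans (cong (sum (f a) +_) (∑ₗ-∑-comm as f)) (sym (∑-distrib-+ (f a) _))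

⊓-+-≤ : ∀ a b k → (a + b) ⊓ k ≤ a ⊓ k + b ⊓ k
⊓-+-≤ zero    b k       = ≤-refl
⊓-+-≤ (suc a) b zero    = z≤n
⊓-+-≤ (suc a) b (suc k) = s≤s (≤-trans (⊓-+-≤ a b k) (+-monoʳ-≤ (a ⊓ k) (⊓-monoʳ-≤ b (n≤1+n k))))

⊓-∑ₗ-≤ : ∀ (as : List A) (f : A → ℕ) k → (∑ₗ as f) ⊓ k ≤ ∑[ a ∈ as ] (f a ⊓ k)
⊓-∑ₗ-≤ []       f k = z≤n
⊓-∑ₗ-≤ (a ∷ as) f k = ≤-trans (⊓-+-≤ (f a) _ k) (+-monoʳ-≤ (f a ⊓ k) (⊓-∑ₗ-≤ as f k))

∑ₗ-⊓2-≥3 : ∀ (as : List A) (f : A → ℕ) → 3 ≤ ∑ₗ as f → All (λ a → f a < ∑ₗ as f) as →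
  3 ≤ ∑[ a ∈ as ] (f a ⊓ 2)
∑ₗ-⊓2-≥3 (a ∷ as) f 3≤∑ (fa<∑ ∷ f<∑) with f a in fa
... | 0 = ∑ₗ-⊓2-≥3 as f 3≤∑ f<∑
... | 1 = s≤s (≤-trans (⊓-glb (≤-pred 3≤∑) ≤-refl) (⊓-∑ₗ-≤ as f 2))
... | suc (suc k) rewrite ⊓-zeroʳ k = s≤s (s≤s (≤-trans (⊓-glb rest≥1 (s≤s z≤n)) (⊓-∑ₗ-≤ as f 2)))
  where
  rest≥1 : 1 ≤ ∑ₗ as f
  rest≥1 = +-cancelˡ-≤ (suc (suc k)) 1 _ (≤-trans (≤-reflexive (+-comm (suc (suc k)) 1)) fa<∑)

∑ₗ-marked+2≤ : ∀ {s} (as : List A) (c : A → Bool) (b : A → ℕ) → ∑[ a ∈ as ] ⟦ c a ⟧ ≡ 1 →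
  All (λ a → ⟦ c a ⟧ + b a < s) as → ∑[ a ∈ as ] (if c a then b a else 0) + 2 ≤ s
∑ₗ-marked+2≤ {s = s} as c b ∑c≡1 small = begin
  ∑ₗ as δ + 2                             ≡⟨ cong (λ k → ∑ₗ as δ + 2 * k) (sym ∑c≡1) ⟩
  ∑ₗ as δ + 2 * ∑[ a ∈ as ] ⟦ c a ⟧       ≡⟨ cong (∑ₗ as δ +_) (sym (∑ₗ-* as 2 (⟦_⟧ ∘ c))) ⟩
  ∑ₗ as δ + ∑[ a ∈ as ] (2 * ⟦ c a ⟧)     ≡⟨ sym (∑ₗ-distrib-+ as δ _) ⟩
  ∑[ a ∈ as ] (δ a + 2 * ⟦ c a ⟧)         ≤⟨ ∑ₗ-mono-≤ (All.map pointwise small) ⟩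
  ∑[ a ∈ as ] (s * ⟦ c a ⟧)               ≡⟨ ∑ₗ-* as s (⟦_⟧ ∘ c) ⟩
  s * ∑[ a ∈ as ] ⟦ c a ⟧                 ≡⟨ trans (cong (s *_) ∑c≡1) (*-identityʳ s) ⟩
  s                                       ∎
  where
  δ = λ a → if c a then b a else 0
  pointwise : ∀ {a} → ⟦ c a ⟧ + b a < s → δ a + 2 * ⟦ c a ⟧ ≤ s * ⟦ c a ⟧
  pointwise {a} lt with c a
  ... | true  = ≤-trans (≤-reflexive (+-comm (b a) 2)) (≤-trans lt (≤-reflexive (sym (*-identityʳ s))))
  ... | false = z≤n

cap : Bool → ℕ
cap true  = 1
cap false = 2

-- Split b into its marked part δ and its unmarked part β.  Either δ sums to 0, and then
-- β sums to s with no term reaching s, or δ sums to at least 1 and β to at least 2.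
∑ₗ-capped-≥3 : ∀ {s} (as : List A) (c : A → Bool) (b : A → ℕ) → 3 ≤ s →
  ∑ₗ as b ≡ s → ∑[ a ∈ as ] ⟦ c a ⟧ ≡ 1 → All (λ a → ⟦ c a ⟧ + b a < s) as →
  3 ≤ ∑[ a ∈ as ] (b a ⊓ cap (c a))
∑ₗ-capped-≥3 {A = A} {s = s} as c b 3≤s ∑b≡s ∑c≡1 small =
  ≤-trans (by-marked (∑ₗ as δ) refl) (∑ₗ-mono-≤ (All.universal split as))
  where
  β δ : A → ℕ
  β a = if c a then 0 else b a
  δ a = if c a then b a else 0

  split : ∀ a → β a ⊓ 2 + δ a ⊓ 1 ≤ b a ⊓ cap (c a)
  split a with c a
  ... | true  = ≤-refl
  ... | false = ≤-reflexive (+-identityʳ _)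

  β+δ≡s : ∑ₗ as β + ∑ₗ as δ ≡ s
  β+δ≡s = trans (sym (∑ₗ-distrib-+ as β δ)) (trans (∑ₗ-cong as pointwise) ∑b≡s)
    where
    pointwise : ∀ a → β a + δ a ≡ b a
    pointwise a with c a
    ... | true  = refl
    ... | false = +-identityʳ (b a)

  ∑-split : ∑ₗ as (λ a → β a ⊓ 2) + ∑ₗ as (λ a → δ a ⊓ 1) ≤ ∑[ a ∈ as ] (β a ⊓ 2 + δ a ⊓ 1)
  ∑-split = ≤-reflexive (sym (∑ₗ-distrib-+ as _ _))

  by-marked : ∀ d → ∑ₗ as δ ≡ d → 3 ≤ ∑[ a ∈ as ] (β a ⊓ 2 + δ a ⊓ 1)
  by-marked 0 ∑δ≡0 =
    ≤-trans (∑ₗ-⊓2-≥3 as β 3≤∑β (All.map β<∑β small)) (≤-trans (m≤m+n _ _) ∑-split)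
    where
    ∑β≡s : ∑ₗ as β ≡ s
    ∑β≡s = trans (sym (+-identityʳ _)) (trans (cong (∑ₗ as β +_) (sym ∑δ≡0)) β+δ≡s)
    3≤∑β : 3 ≤ ∑ₗ as β
    3≤∑β = ≤-trans 3≤s (≤-reflexive (sym ∑β≡s))
    β<∑β : ∀ {a} → ⟦ c a ⟧ + b a < s → β a < ∑ₗ as β
    β<∑β {a} lt with c a
    ... | true  = ≤-trans (s≤s z≤n) 3≤∑β
    ... | false = ≤-trans lt (≤-reflexive (sym ∑β≡s))
  by-marked (suc d) ∑δ≡1+d = ≤-trans (+-mono-≤ (≤-trans (⊓-glb 2≤∑β ≤-refl) (⊓-∑ₗ-≤ as β 2))
                                                (≤-trans (⊓-glb 1≤∑δ ≤-refl) (⊓-∑ₗ-≤ as δ 1)))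
                                     ∑-split
    where
    1≤∑δ : 1 ≤ ∑ₗ as δ
    1≤∑δ = ≤-trans (s≤s z≤n) (≤-reflexive (sym ∑δ≡1+d))
    2≤∑β : 2 ≤ ∑ₗ as β
    2≤∑β = +-cancelʳ-≤ (∑ₗ as δ) 2 _
      (≤-trans (≤-reflexive (+-comm 2 _))
               (≤-trans (∑ₗ-marked+2≤ as c b ∑c≡1 small) (≤-reflexive (sym β+δ≡s))))

VSet : ℕ → Set
VSet n = Fin n → Bool

∣_∣ : VSet n → ℕ
∣_∣ {n} X = ∑[ x < n ] ⟦ X x ⟧

infixl 7 _∩_
_∩_ : VSet n → VSet n → VSet n
(X ∩ Y) x = X x ∧ Y x

full : VSet n
full _ = true

⁅_⁆ : Fin n → VSet n
⁅ x ⁆ y = does (y ≟ x)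

infixl 6 _─_
_─_ : VSet n → Fin n → VSet n
(X ─ x) y = X y ∧ not (does (y ≟ x))

Disjoint : VSet n → VSet n → Set
Disjoint X Y = ∀ {x} → X x ≡ true → Y x ≡ true → ⊥

variable
  X Y Z S : VSet n
  x y z : Fin n

∩-elimˡ : (X ∩ Y) x ≡ true → X x ≡ true
∩-elimˡ {X = X} {x = x} X∩Y∋x with X x
... | true  = refl
... | false = X∩Y∋x

∩-elimʳ : (X ∩ Y) x ≡ true → Y x ≡ true
∩-elimʳ {X = X} {x = x} X∩Y∋x with X x
... | true  = X∩Y∋x
... | false = contradiction X∩Y∋x λ ()

∣∣-cong : (∀ x → X x ≡ Y x) → ∣ X ∣ ≡ ∣ Y ∣
∣∣-cong X≗Y = sum-cong-≗ (cong ⟦_⟧ ∘ X≗Y)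

∣∣-mono : (∀ {x} → X x ≡ true → Y x ≡ true) → ∣ X ∣ ≤ ∣ Y ∣
∣∣-mono {X = X} {Y = Y} X⊆Y = ∑-mono-≤ pointwise
  where
  pointwise : ∀ x → ⟦ X x ⟧ ≤ ⟦ Y x ⟧
  pointwise x with X x in Xx
  ... | false = z≤n
  ... | true  rewrite X⊆Y Xx = ≤-refl

∣∩∣≤∣∣ˡ : ∣ X ∩ Y ∣ ≤ ∣ X ∣
∣∩∣≤∣∣ˡ {X = X} {Y = Y} = ∣∣-mono {X = X ∩ Y} {Y = X} (∩-elimˡ {X = X} {Y = Y})

∣∩∣≤∣∣ʳ : ∣ X ∩ Y ∣ ≤ ∣ Y ∣
∣∩∣≤∣∣ʳ {X = X} {Y = Y} = ∣∣-mono {X = X ∩ Y} {Y = Y} (∩-elimʳ {X = X} {Y = Y})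

∣∣-split : (∀ x → ⟦ X x ⟧ ≡ ⟦ Y x ⟧ + ⟦ Z x ⟧) → ∣ X ∣ ≡ ∣ Y ∣ + ∣ Z ∣
∣∣-split {Y = Y} {Z = Z} split = trans (sum-cong-≗ split) (∑-distrib-+ (⟦_⟧ ∘ Y) (⟦_⟧ ∘ Z))

∣∩∣-disjoint : Disjoint X Y → ∣ X ∩ S ∣ + ∣ Y ∩ S ∣ ≤ ∣ S ∣
∣∩∣-disjoint {X = X} {Y = Y} {S = S} X∩Y≡∅ =
  ≤-trans (≤-reflexive (sym (∑-distrib-+ (⟦_⟧ ∘ (X ∩ S)) (⟦_⟧ ∘ (Y ∩ S))))) (∑-mono-≤ pointwise)
  where
  pointwise : ∀ x → ⟦ X x ∧ S x ⟧ + ⟦ Y x ∧ S x ⟧ ≤ ⟦ S x ⟧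
  pointwise x with X x in Xx | Y x in Yx | S x
  ... | true  | true  | _     = ⊥-elim (X∩Y≡∅ Xx Yx)
  ... | true  | false | true  = ≤-refl
  ... | true  | false | false = z≤n
  ... | false | true  | true  = ≤-refl
  ... | false | true  | false = z≤n
  ... | false | false | _     = z≤n

∣∩⁅⁆∣ : ∀ (X : VSet n) x → ∣ X ∩ ⁅ x ⁆ ∣ ≡ ⟦ X x ⟧
∣∩⁅⁆∣ {suc n} X zero = trans
  (cong₂ _+_ (cong ⟦_⟧ (∧-identityʳ (X zero)))
             (trans (sum-cong-≗ (λ y → cong ⟦_⟧ (∧-zeroʳ (X (suc y))))) (sum-replicate-zero n)))
  (+-identityʳ _)
∣∩⁅⁆∣ {suc n} X (suc x) = cong₂ _+_ (cong ⟦_⟧ (∧-zeroʳ (X zero))) (∣∩⁅⁆∣ (X ∘ suc) x)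

∣∣-remove : ∀ (X : VSet n) x → ∣ X ∣ ≡ ⟦ X x ⟧ + ∣ X ─ x ∣
∣∣-remove X x =
  trans (∣∣-split {Y = X ∩ ⁅ x ⁆} {Z = X ─ x} pointwise) (cong (_+ ∣ X ─ x ∣) (∣∩⁅⁆∣ X x))
  where
  pointwise : ∀ y → ⟦ X y ⟧ ≡ ⟦ X y ∧ does (y ≟ x) ⟧ + ⟦ X y ∧ not (does (y ≟ x)) ⟧
  pointwise y with X y | does (y ≟ x)
  ... | false | _     = refl
  ... | true  | true  = refl
  ... | true  | false = refl

∈─ : X y ≡ true → y ≢ x → (X ─ x) y ≡ true
∈─ {y = y} {x = x} Xy y≢x with y ≟ x
... | yes y≡x = contradiction y≡x y≢x
... | no  _   = trans (∧-identityʳ _) Xy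

∣∣-remove-∈ : X x ≡ true → ∣ X ∣ ≡ suc ∣ X ─ x ∣
∣∣-remove-∈ {X = X} {x = x} Xx = trans (∣∣-remove X x) (cong (λ b → ⟦ b ⟧ + ∣ X ─ x ∣) Xx)

0<∣∣ : X x ≡ true → 0 < ∣ X ∣
0<∣∣ {X = X} Xx = ≤-trans (s≤s z≤n) (≤-reflexive (sym (∣∣-remove-∈ {X = X} Xx)))

1<∣∣ : x ≢ y → X x ≡ true → X y ≡ true → 1 < ∣ X ∣
1<∣∣ {X = X} x≢y Xx Xy =
  ≤-trans (s≤s (0<∣∣ {X = X ─ _} (∈─ {X = X} Xy (x≢y ∘ sym))))
          (≤-reflexive (sym (∣∣-remove-∈ {X = X} Xx)))

2<∣∣ : x ≢ y → x ≢ z → y ≢ z → X x ≡ true → X y ≡ true → X z ≡ true → 2 < ∣ X ∣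
2<∣∣ {X = X} x≢y x≢z y≢z Xx Xy Xz =
  ≤-trans (s≤s (1<∣∣ {X = X ─ _} y≢z (∈─ {X = X} Xy (x≢y ∘ sym)) (∈─ {X = X} Xz (x≢z ∘ sym))))
          (≤-reflexive (sym (∣∣-remove-∈ {X = X} Xx)))

∣full∣ : ∣ full {n} ∣ ≡ n
∣full∣ {zero}  = refl
∣full∣ {suc n} = cong suc (∣full∣ {n})

∣∣≡1⇒singleton : ∀ {n} {X : VSet n} → ∣ X ∣ ≡ 1 →
  ∃ λ w → X w ≡ true × (∀ {x} → X x ≡ true → x ≡ w)
∣∣≡1⇒singleton {n} {X} ∣X∣≡1 with any? (λ x → X x Bool.≟ true)
... | no  empty = contradiction (trans (sym ∣X∣≡1) ∣X∣≡0) λ ()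
  where
  ∣X∣≡0 : ∣ X ∣ ≡ 0
  ∣X∣≡0 = trans (∣∣-cong {Y = λ _ → false} (λ x → ¬-not (empty ∘ (x ,_)))) (sum-replicate-zero n)
... | yes (w , Xw) = w , Xw , only-w
  where
  only-w : ∀ {x} → X x ≡ true → x ≡ w
  only-w {x} Xx with x ≟ w
  ... | yes x≡w = x≡w
  ... | no  x≢w = contradiction (≤-trans (1<∣∣ {X = X} x≢w Xx Xw) (≤-reflexive ∣X∣≡1)) λ { (s≤s ()) }

laman : ℕ → ℕ
laman 0             = 0
laman 1             = 0
laman (suc (suc k)) = suc (k + k)

n≤laman[1+n] : ∀ k → k ≤ laman (suc k)
n≤laman[1+n] zero    = z≤n
n≤laman[1+n] (suc k) = s≤s (m≤m+n k k)

laman-pos : ∀ {k} → 2 ≤ k → 0 < laman k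
laman-pos {suc (suc k)} _ = s≤s z≤n
laman-pos {1}           (s≤s ())

laman-suc : ∀ {k} → 2 ≤ k → laman (suc k) ≡ 2 + laman k
laman-suc {suc (suc k)} _ = cong (2 +_) (+-suc k k)
laman-suc {1} (s≤s ())

laman-four : ∀ {k} → 2 ≤ k → 2 + ((2 + laman k) + (2 + laman k)) ≡ 4 * k
laman-four {suc (suc k)} _ = lemma k
  where
  lemma : ∀ k → 2 + ((2 + suc (k + k)) + (2 + suc (k + k))) ≡ 4 * suc (suc k)
  lemma = solve-∀
laman-four {1} (s≤s ())

gain : Bool → ℕ → ℕ → ℕ
gain _     zero          _             = 0
gain _     (suc _)       zero          = 0
gain true  (suc _)       (suc _)       = 1
gain false 1             1             = 1
gain false 1             (suc (suc _)) = 2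
gain false (suc (suc _)) 1             = 2
gain false (suc (suc _)) (suc (suc _)) = 3

laman-split : ∀ c a b → laman (⟦ c ⟧ + (a + b)) ≡ laman (⟦ c ⟧ + a) + laman (⟦ c ⟧ + b) + gain c a b
laman-split false zero          b             = sym (+-identityʳ _)
laman-split true  zero          b             = sym (+-identityʳ _)
laman-split false (suc a)       zero          =
  trans (cong laman (+-identityʳ (suc a))) (sym (trans (+-identityʳ _) (+-identityʳ _)))
laman-split true  (suc a)       zero          =
  trans (cong (laman ∘ suc) (+-identityʳ (suc a))) (sym (trans (+-identityʳ _) (+-identityʳ _)))
laman-split true  (suc a)       (suc b)       = lemma a b
  where
  lemma : ∀ a b → suc ((a + suc b) + (a + suc b)) ≡ suc (a + a) + suc (b + b) + 1
  lemma = solve-∀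
laman-split false 1             1             = refl
laman-split false 1             (suc (suc b)) = lemma b
  where
  lemma : ∀ b → suc (suc b + suc b) ≡ 0 + suc (b + b) + 2
  lemma = solve-∀
laman-split false (suc (suc a)) 1             = lemma a
  where
  lemma : ∀ a → suc ((a + 1) + (a + 1)) ≡ suc (a + a) + 0 + 2
  lemma = solve-∀
laman-split false (suc (suc a)) (suc (suc b)) = lemma a b
  where
  lemma : ∀ a b → suc ((a + suc (suc b)) + (a + suc (suc b))) ≡ suc (a + a) + suc (b + b) + 3
  lemma = solve-∀

gain-comm : ∀ c a b → gain c a b ≡ gain c b a
gain-comm c     zero          zero          = refl
gain-comm c     zero          (suc b)       = refl
gain-comm c     (suc a)       zero          = refl
gain-comm true  (suc a)       (suc b)       = refl
gain-comm false 1             1             = refl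
gain-comm false 1             (suc (suc b)) = refl
gain-comm false (suc (suc a)) 1             = refl
gain-comm false (suc (suc a)) (suc (suc b)) = refl

gain-cut : ∀ c {a b} → 1 ≤ a → 1 ≤ b → 1 ≤ gain c a b
gain-cut true  {suc a}       {suc b}       _ _ = ≤-refl
gain-cut false {1}           {1}           _ _ = ≤-refl
gain-cut false {1}           {suc (suc b)} _ _ = s≤s z≤n
gain-cut false {suc (suc a)} {1}           _ _ = s≤s z≤n
gain-cut false {suc (suc a)} {suc (suc b)} _ _ = s≤s z≤n

gain-cut₂ : ∀ {a b} → 1 ≤ a → 1 ≤ b → 3 ≤ a + b → 2 ≤ gain false a b
gain-cut₂ {1}           {1}           _ _ (s≤s (s≤s ()))
gain-cut₂ {1}           {suc (suc b)} _ _ _ = ≤-refl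
gain-cut₂ {suc (suc a)} {1}           _ _ _ = ≤-refl
gain-cut₂ {suc (suc a)} {suc (suc b)} _ _ _ = s≤s (s≤s z≤n)

gain-cut₃ : ∀ {a b} → 2 ≤ a → 2 ≤ b → 3 ≤ gain false a b
gain-cut₃ {suc (suc a)} {suc (suc b)} _ _ = ≤-refl
gain-cut₃ {1}           (s≤s ()) _
gain-cut₃ {suc (suc a)} {1}      _ (s≤s ())

gain-capped : ∀ c {a} b → 1 ≤ a → b ⊓ cap c ≤ gain c a b
gain-capped c     {suc a}       zero          _ = z≤n
gain-capped true  {suc a}       (suc b)       _ = s≤s (≤-reflexive (⊓-zeroʳ b))
gain-capped false {1}           1             _ = ≤-refl
gain-capped false {1}           (suc (suc b)) _ = s≤s (s≤s (≤-reflexive (⊓-zeroʳ b)))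
gain-capped false {suc (suc a)} 1             _ = s≤s z≤n
gain-capped false {suc (suc a)} (suc (suc b)) _ = s≤s (s≤s (≤-trans (m⊓n≤n b 0) z≤n))

record Separator (n : ℕ) : Set where
  field
    label         : Labelling n
    centre        : Fin n
    label-centre  : label centre ≡ 2F
    centre-unique : ∀ {x} → label x ≡ 2F → x ≡ centre
open Separator public

V₁ V₂ V₁⁺ V₂⁺ : Separator n → VSet n
V₁  σ x = does (label σ x ≟ 0F)
V₂  σ x = does (label σ x ≟ 1F)
V₁⁺ σ x = not (V₂ σ x)
V₂⁺ σ x = not (V₁ σ x)

centre-class : ∀ (σ : Separator n) x → does (label σ x ≟ 2F) ≡ does (x ≟ centre σ)
centre-class σ x with label σ x in lx | x ≟ centre σ
... | 0F | yes refl = contradiction (trans (sym lx) (label-centre σ)) λ ()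
... | 1F | yes refl = contradiction (trans (sym lx) (label-centre σ)) λ ()
... | 2F | yes _    = refl
... | 0F | no  _    = refl
... | 1F | no  _    = refl
... | 2F | no  x≢w  = contradiction (centre-unique σ lx) x≢w

module _ (σ : Separator n) (X : VSet n) where
  private
    W : VSet n
    W x = does (label σ x ≟ 2F)

    ∣X∩W∣ : ∣ X ∩ W ∣ ≡ ⟦ X (centre σ) ⟧
    ∣X∩W∣ = trans (∣∣-cong (λ x → cong (X x ∧_) (centre-class σ x))) (∣∩⁅⁆∣ X (centre σ))

  ∣∣-by-sides : ∀ {c} → X (centre σ) ≡ c → ∣ X ∣ ≡ ⟦ c ⟧ + (∣ X ∩ V₁ σ ∣ + ∣ X ∩ V₂ σ ∣)
  ∣∣-by-sides refl = trans (sum-cong-≗ pointwise)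
    (trans (∑-distrib-+ (⟦_⟧ ∘ (X ∩ W)) (λ x → ⟦ (X ∩ V₁ σ) x ⟧ + ⟦ (X ∩ V₂ σ) x ⟧))
           (cong₂ _+_ ∣X∩W∣ (∑-distrib-+ (⟦_⟧ ∘ (X ∩ V₁ σ)) (⟦_⟧ ∘ (X ∩ V₂ σ)))))
    where
    pointwise : ∀ x → ⟦ X x ⟧ ≡ ⟦ X x ∧ W x ⟧ + (⟦ X x ∧ V₁ σ x ⟧ + ⟦ X x ∧ V₂ σ x ⟧)
    pointwise x with X x | label σ x
    ... | false | _  = refl
    ... | true  | 0F = refl
    ... | true  | 1F = refl
    ... | true  | 2F = refl

  ∣∩V₁⁺∣ : ∀ {c} → X (centre σ) ≡ c → ∣ X ∩ V₁⁺ σ ∣ ≡ ⟦ c ⟧ + ∣ X ∩ V₁ σ ∣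
  ∣∩V₁⁺∣ refl =
    trans (∣∣-split {Y = X ∩ W} {Z = X ∩ V₁ σ} pointwise) (cong (_+ ∣ X ∩ V₁ σ ∣) ∣X∩W∣)
    where
    pointwise : ∀ x → ⟦ X x ∧ V₁⁺ σ x ⟧ ≡ ⟦ X x ∧ W x ⟧ + ⟦ X x ∧ V₁ σ x ⟧
    pointwise x with X x | label σ x
    ... | false | _  = refl
    ... | true  | 0F = refl
    ... | true  | 1F = refl
    ... | true  | 2F = refl

  ∣∩V₂⁺∣ : ∀ {c} → X (centre σ) ≡ c → ∣ X ∩ V₂⁺ σ ∣ ≡ ⟦ c ⟧ + ∣ X ∩ V₂ σ ∣
  ∣∩V₂⁺∣ refl =
    trans (∣∣-split {Y = X ∩ W} {Z = X ∩ V₂ σ} pointwise) (cong (_+ ∣ X ∩ V₂ σ ∣) ∣X∩W∣)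
    where
    pointwise : ∀ x → ⟦ X x ∧ V₂⁺ σ x ⟧ ≡ ⟦ X x ∧ W x ⟧ + ⟦ X x ∧ V₂ σ x ⟧
    pointwise x with X x | label σ x
    ... | false | _  = refl
    ... | true  | 0F = refl
    ... | true  | 1F = refl
    ... | true  | 2F = refl

  refinement-gain : ℕ
  refinement-gain = gain (X (centre σ)) ∣ X ∩ V₁ σ ∣ ∣ X ∩ V₂ σ ∣

  refinement-gain-at : ∀ {c} → X (centre σ) ≡ c →
    refinement-gain ≡ gain c ∣ X ∩ V₁ σ ∣ ∣ X ∩ V₂ σ ∣
  refinement-gain-at refl = refl

  laman-refine : laman ∣ X ∣ ≡ laman ∣ X ∩ V₁⁺ σ ∣ + laman ∣ X ∩ V₂⁺ σ ∣ + refinement-gain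
  laman-refine = trans (cong laman (∣∣-by-sides refl)) (trans (laman-split (X (centre σ)) _ _)
    (cong₂ (λ p q → laman p + laman q + refinement-gain) (sym (∣∩V₁⁺∣ refl)) (sym (∣∩V₂⁺∣ refl))))

refine : Separator n → List (VSet n) → List (VSet n)
refine σ []      = []
refine σ (X ∷ C) = X ∩ V₁⁺ σ ∷ X ∩ V₂⁺ σ ∷ refine σ C

capacity : List (VSet n) → ℕ
capacity C = ∑[ X ∈ C ] laman ∣ X ∣

gains : Separator n → List (VSet n) → ℕ
gains σ C = ∑[ X ∈ C ] refinement-gain σ X

capacity-refine : ∀ (σ : Separator n) C → capacity C ≡ gains σ C + capacity (refine σ C)
capacity-refine σ []      = refl
capacity-refine σ (X ∷ C) =
  trans (cong₂ _+_ (laman-refine σ X) (capacity-refine σ C))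
        (regroup (laman ∣ X ∩ V₁⁺ σ ∣) (laman ∣ X ∩ V₂⁺ σ ∣) (refinement-gain σ X)
                 (gains σ C) (capacity (refine σ C)))
  where
  regroup : ∀ p q g G c → p + q + g + (G + c) ≡ g + G + (p + (q + c))
  regroup = solve-∀

flip : Fin 3 → Fin 3
flip 0F = 1F
flip 1F = 0F
flip 2F = 2F

flip-involutive : ∀ c → flip (flip c) ≡ c
flip-involutive 0F = refl
flip-involutive 1F = refl
flip-involutive 2F = refl

flip⁻¹ : ∀ {c d} → flip c ≡ d → c ≡ flip d
flip⁻¹ {c} eq = trans (sym (flip-involutive c)) (cong flip eq)

swap : Separator n → Separator n
swap σ = record
  { label         = flip ∘ label σ
  ; centre        = centre σ
  ; label-centre  = cong flip (label-centre σ)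
  ; centre-unique = centre-unique σ ∘ flip⁻¹
  }

V₁-swap : ∀ (σ : Separator n) x → V₁ (swap σ) x ≡ V₂ σ x
V₁-swap σ x with label σ x
... | 0F = refl
... | 1F = refl
... | 2F = refl

V₂-swap : ∀ (σ : Separator n) x → V₂ (swap σ) x ≡ V₁ σ x
V₂-swap σ x with label σ x
... | 0F = refl
... | 1F = refl
... | 2F = refl

∣∩V₁-swap∣ : ∀ (σ : Separator n) X → ∣ X ∩ V₁ (swap σ) ∣ ≡ ∣ X ∩ V₂ σ ∣
∣∩V₁-swap∣ σ X = ∣∣-cong (λ x → cong (X x ∧_) (V₁-swap σ x))

∣∩V₂-swap∣ : ∀ (σ : Separator n) X → ∣ X ∩ V₂ (swap σ) ∣ ≡ ∣ X ∩ V₁ σ ∣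
∣∩V₂-swap∣ σ X = ∣∣-cong (λ x → cong (X x ∧_) (V₂-swap σ x))

gains-swap : ∀ (σ : Separator n) C → gains (swap σ) C ≡ gains σ C
gains-swap σ C = ∑ₗ-cong C λ X →
  trans (cong₂ (gain (X (centre σ))) (∣∩V₁-swap∣ σ X) (∣∩V₂-swap∣ σ X)) (gain-comm _ _ _)

record Inside (X : VSet n) (e : Edge n) : Set where
  constructor _,_
  field
    first  : X (proj₁ e) ≡ true
    second : X (proj₂ e) ≡ true

Covers : List (VSet n) → List (Edge n) → Set
Covers C = All (λ e → Any (λ X → Inside X e) C)

NonLoop : Edge n → Set
NonLoop (i , j) = i ≢ j

variable
  s t : ℕ
  e : Edge n
  L : List (Edge n)
  C : List (VSet n)
  p : Labelling n

inside-∩ˡ : ∀ {X Y : VSet n} e → Inside (X ∩ Y) e → Inside X e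
inside-∩ˡ {X = X} {Y} (i , j) (Xi , Xj) = ∩-elimˡ {X = X} {Y = Y} Xi , ∩-elimˡ {X = X} {Y = Y} Xj

small-no-inside : ∀ {X : VSet n} e → ∣ X ∣ ≤ 1 → NonLoop e → ¬ Inside X e
small-no-inside {X = X} (i , j) ∣X∣≤1 i≢j (Xi , Xj) = ≤⇒≯ ∣X∣≤1 (1<∣∣ {X = X} i≢j Xi Xj)

crosses-sym : ∀ {i j : Fin n} → Crosses p (i , j) → Crosses p (j , i)
crosses-sym (inj₁ (pi , pj)) = inj₂ (pj , pi)
crosses-sym (inj₂ (pi , pj)) = inj₁ (pj , pi)

crosses-flip : ∀ e → Crosses p e → Crosses (flip ∘ p) e
crosses-flip _ (inj₁ (pi , pj)) = inj₂ (cong flip pi , cong flip pj)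
crosses-flip _ (inj₂ (pi , pj)) = inj₁ (cong flip pi , cong flip pj)

crosses-unflip : ∀ e → Crosses (flip ∘ p) e → Crosses p e
crosses-unflip _ (inj₁ (pi , pj)) = inj₂ (flip⁻¹ pi , flip⁻¹ pj)
crosses-unflip _ (inj₂ (pi , pj)) = inj₁ (flip⁻¹ pi , flip⁻¹ pj)

crossing⇒nonloop : ∀ e → Crosses p e → NonLoop e
crossing⇒nonloop _ (inj₁ (pi , pj)) refl = contradiction (trans (sym pi) pj) λ ()
crossing⇒nonloop _ (inj₂ (pi , pj)) refl = contradiction (trans (sym pi) pj) λ ()

noncrossing-side : ∀ {i j : Fin n} → ¬ Crosses p (i , j) →
  (p i ≢ 1F × p j ≢ 1F) ⊎ (p i ≢ 0F × p j ≢ 0F)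
noncrossing-side {p = p} {i} {j} ¬cross with p i | p j
... | 0F | 1F = contradiction (inj₁ (refl , refl)) ¬cross
... | 1F | 0F = contradiction (inj₂ (refl , refl)) ¬cross
... | 0F | 0F = inj₁ ((λ ()) , (λ ()))
... | 0F | 2F = inj₁ ((λ ()) , (λ ()))
... | 2F | 0F = inj₁ ((λ ()) , (λ ()))
... | 2F | 2F = inj₁ ((λ ()) , (λ ()))
... | 1F | 1F = inj₂ ((λ ()) , (λ ()))
... | 1F | 2F = inj₂ ((λ ()) , (λ ()))
... | 2F | 1F = inj₂ ((λ ()) , (λ ()))

∈V₁⁺ : ∀ (σ : Separator n) → X x ≡ true → label σ x ≢ 1F → (X ∩ V₁⁺ σ) x ≡ true
∈V₁⁺ {x = x} σ Xx x∉V₂ = cong₂ _∧_ Xx (cong not (dec-false (label σ x ≟ 1F) x∉V₂))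

∈V₂⁺ : ∀ (σ : Separator n) → X x ≡ true → label σ x ≢ 0F → (X ∩ V₂⁺ σ) x ≡ true
∈V₂⁺ {x = x} σ Xx x∉V₁ = cong₂ _∧_ Xx (cong not (dec-false (label σ x ≟ 0F) x∉V₁))

inside-refine : ∀ (σ : Separator n) {X} e → ¬ Crosses (label σ) e → Inside X e →
  Inside (X ∩ V₁⁺ σ) e ⊎ Inside (X ∩ V₂⁺ σ) e
inside-refine σ {X} (i , j) ¬cross (Xi , Xj) with noncrossing-side {p = label σ} ¬cross
... | inj₁ (i∉V₂ , j∉V₂) = inj₁ (∈V₁⁺ {X = X} σ Xi i∉V₂ , ∈V₁⁺ {X = X} σ Xj j∉V₂)
... | inj₂ (i∉V₁ , j∉V₁) = inj₂ (∈V₂⁺ {X = X} σ Xi i∉V₁ , ∈V₂⁺ {X = X} σ Xj j∉V₁)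

refine-covers : ∀ (σ : Separator n) → All (¬_ ∘ Crosses (label σ)) L → Covers C L → Covers (refine σ C) L
refine-covers σ avoided cov = All.zipWith (uncurry any-refine) (avoided , cov)
  where
  any-refine : ¬ Crosses (label σ) e → Any (λ X → Inside X e) C → Any (λ X → Inside X e) (refine σ C)
  any-refine {e = e} ¬cross (here {X} e⊆X) with inside-refine σ {X} e ¬cross e⊆X
  ... | inj₁ e⊆X₁ = here e⊆X₁
  ... | inj₂ e⊆X₂ = there (here e⊆X₂)
  any-refine ¬cross (there e∈C) = there (there (any-refine ¬cross e∈C))

crossing-sides : ∀ (σ : Separator n) {X} e → Crosses (label σ) e → Inside X e →
  0 < ∣ X ∩ V₁ σ ∣ × 0 < ∣ X ∩ V₂ σ ∣
crossing-sides σ {X} (i , j) (inj₁ (li , lj)) (Xi , Xj) =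
  0<∣∣ {X = X ∩ V₁ σ} (cong₂ _∧_ Xi (cong (λ c → does (c ≟ 0F)) li)) ,
  0<∣∣ {X = X ∩ V₂ σ} (cong₂ _∧_ Xj (cong (λ c → does (c ≟ 1F)) lj))
crossing-sides σ {X} (i , j) (inj₂ (li , lj)) (Xi , Xj) =
  0<∣∣ {X = X ∩ V₁ σ} (cong₂ _∧_ Xj (cong (λ c → does (c ≟ 0F)) lj)) ,
  0<∣∣ {X = X ∩ V₂ σ} (cong₂ _∧_ Xi (cong (λ c → does (c ≟ 1F)) li))

crossing-gain : ∀ (σ : Separator n) e → Crosses (label σ) e → Any (λ X → Inside X e) C → 0 < gains σ C
crossing-gain σ e cross (here {X} e⊆X) =
  ≤-trans (uncurry (gain-cut (X (centre σ))) (crossing-sides σ {X} e cross e⊆X)) (m≤m+n _ _)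
crossing-gain σ e cross (there e∈C) = ≤-trans (crossing-gain σ e cross e∈C) (m≤n+m _ _)

record ErasureStep (s t : ℕ) (e : Edge n) (rest : List (Edge n)) : Set where
  field
    separator : Separator n
    ∣V₁∣      : ∣ V₁ separator ∣ ≡ s
    ∣V₂∣      : ∣ V₂ separator ∣ ≡ t
    crosses   : Crosses (label separator) e
    avoids    : All (¬_ ∘ Crosses (label separator)) rest
open ErasureStep public

length-filter-tabulate : ∀ {P : A → Set} (P? : ∀ a → Dec (P a)) (f : Fin n → A) →
  length (filter P? (tabulate f)) ≡ ∑[ i < n ] ⟦ does (P? (f i)) ⟧
length-filter-tabulate {n = zero}  P? f = refl
length-filter-tabulate {n = suc n} P? f with does (P? (f zero))
... | true  = cong suc (length-filter-tabulate P? (f ∘ suc))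
... | false = length-filter-tabulate P? (f ∘ suc)

classSize-∣∣ : ∀ (p : Labelling n) k → classSize p k ≡ ∣ (λ x → does (p x ≟ k)) ∣
classSize-∣∣ p k = length-filter-tabulate (λ x → p x ≟ k) (λ x → x)

≟-sound : ∀ {c d : Fin 3} → does (c ≟ d) ≡ true → c ≡ d
≟-sound {c} {d} c≟d with c ≟ d
... | yes c≡d = c≡d
... | no  _   = contradiction c≟d λ ()

erasure-step : ∀ {rest} → ErasableIn s t (e ∷ rest) e → All (e ≢_) rest → ErasureStep s t e rest
erasure-step (p , (∣V₁∣≡s , ∣V₂∣≡t , ∣W∣≡1) , _ , cross , _ ∷ only-e) e∉rest
  with ∣∣≡1⇒singleton (trans (sym (classSize-∣∣ p 2F)) ∣W∣≡1)
... | w , pw , only-w = record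
  { separator = record
    { label         = p
    ; centre        = w
    ; label-centre  = ≟-sound pw
    ; centre-unique = λ {x} px → only-w (dec-true (p x ≟ 2F) px)
    }
  ; ∣V₁∣    = trans (sym (classSize-∣∣ p 0F)) ∣V₁∣≡s
  ; ∣V₂∣    = trans (sym (classSize-∣∣ p 1F)) ∣V₂∣≡t
  ; crosses = cross
  ; avoids  = All.zipWith (λ (only , e≢f) crossing → e≢f (sym (only crossing))) (only-e , e∉rest)
  }

swap-step : ErasureStep s s e L → ErasureStep s s e L
swap-step {e = e} st = record
  { separator = swap (separator st)
  ; ∣V₁∣      = trans (∣∩V₁-swap∣ (separator st) full) (∣V₂∣ st)
  ; ∣V₂∣      = trans (∣∩V₂-swap∣ (separator st) full) (∣V₁∣ st)
  ; crosses   = crosses-flip {p = label (separator st)} e (crosses st)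
  ; avoids    = All.map (λ {f} ¬cross → ¬cross ∘ crosses-unflip {p = label (separator st)} f) (avoids st)
  }

side-of : ∀ (σ : Separator n) {v} → centre σ ≢ v → label σ v ≡ 0F ⊎ label (swap σ) v ≡ 0F
side-of σ {v} w≢v with label σ v in lv
... | 0F = inj₁ refl
... | 1F = inj₂ refl
... | 2F = contradiction (sym (centre-unique σ lv)) w≢v

erasing-nonloops : ErasingOrder s t L → All NonLoop L
erasing-nonloops {L = []}    _ = []
erasing-nonloops {L = e ∷ L} ((p , _ , _ , cross , _) , eo) =
  crossing⇒nonloop {p = p} e cross ∷ erasing-nonloops eo

cover-bound : ErasingOrder s t L → Unique L → Covers C L → length L ≤ capacity C
refine-bound : ∀ {k} (st : ErasureStep s t e L) → ErasingOrder s t L → Unique L → Covers C L →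
  k ≤ gains (separator st) C → k + length L ≤ capacity C

cover-bound {L = []}    _ _ _ = z≤n
cover-bound {L = e ∷ L} (erasable , eo) (e∉L ∷ u) (e∈C ∷ cov) =
  refine-bound st eo u cov (crossing-gain (separator st) e (crosses st) e∈C)
  where
  st = erasure-step erasable e∉L

refine-bound {L = L} {C = C} {k = k} st eo u cov k≤gains = begin
  k + length L                      ≤⟨ +-mono-≤ k≤gains (cover-bound eo u (refine-covers σ (avoids st) cov)) ⟩
  gains σ C + capacity (refine σ C) ≡⟨ sym (capacity-refine σ C) ⟩
  capacity C                        ∎
  where
  σ = separator st

covers-map : ∀ {P : Edge n → Set} {D} → All P L →
  (∀ {f} → P f → Any (λ X → Inside X f) C → Any (λ X → Inside X f) D) → Covers C L → Covers D L
covers-map Ps move cov = All.zipWith (uncurry move) (Ps , cov)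

drop-small : ∀ D {B D′} → ∣ B ∣ ≤ 1 → All NonLoop L → Covers (D ++ B ∷ D′) L → Covers (D ++ D′) L
drop-small D ∣B∣≤1 nonloops = covers-map nonloops move
  where
  move : ∀ {f} → NonLoop f → Any (λ Z → Inside Z f) (D ++ _ ∷ _) → Any (λ Z → Inside Z f) (D ++ _)
  move f↺ f∈ with ++⁻ D f∈
  ... | inj₁ f∈D          = ++⁺ˡ f∈D
  ... | inj₂ (here f⊆B)   = contradiction f⊆B (small-no-inside _ ∣B∣≤1 f↺)
  ... | inj₂ (there f∈D′) = ++⁺ʳ D f∈D′

endpoint : ∀ {E : VSet n} {i j k} → ∣ E ∣ ≤ 2 → i ≢ j → E i ≡ true → E j ≡ true → E k ≡ true →
  k ≡ i ⊎ k ≡ j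
endpoint {E = E} {i} {j} {k} ∣E∣≤2 i≢j Ei Ej Ek with k ≟ i | k ≟ j
... | yes k≡i | _       = inj₁ k≡i
... | no  _   | yes k≡j = inj₂ k≡j
... | no  k≢i | no  k≢j =
  contradiction (2<∣∣ {X = E} i≢j (k≢i ∘ sym) (k≢j ∘ sym) Ei Ej Ek) (≤⇒≯ ∣E∣≤2)

-- Two vertices carry at most one edge up to orientation.
pair-crossing : ∀ {E : VSet n} e f → ∣ E ∣ ≤ 2 → Inside E e → Inside E f → NonLoop e → NonLoop f →
  Crosses p e → Crosses p f
pair-crossing {p = p} (i , j) (k , l) ∣E∣≤2 (Ei , Ej) (Ek , El) i≢j k≢l cross
  with endpoint ∣E∣≤2 i≢j Ei Ej Ek | endpoint ∣E∣≤2 i≢j Ei Ej El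
... | inj₁ refl | inj₁ refl = contradiction refl k≢l
... | inj₁ refl | inj₂ refl = cross
... | inj₂ refl | inj₁ refl = crosses-sym {p = p} cross
... | inj₂ refl | inj₂ refl = contradiction refl k≢l

record Sunflower (v : Fin n) (C : List (VSet n)) : Set where
  field
    core∈  : All (λ X → X v ≡ true) C
    petals : ∀ {x} → x ≢ v → ∑[ X ∈ C ] ⟦ X x ⟧ ≡ 1
open Sunflower public

variable
  v : Fin n
  P Q : VSet n

sunflower-∑ : Sunflower v C → S v ≡ false → ∑[ X ∈ C ] ∣ X ∩ S ∣ ≡ ∣ S ∣
sunflower-∑ {v = v} {C = C} {S = S} sf Sv =
  trans (∑ₗ-∑-comm C (λ X x → ⟦ X x ∧ S x ⟧)) (sum-cong-≗ pointwise)
  where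
  pointwise : ∀ x → ∑[ X ∈ C ] ⟦ X x ∧ S x ⟧ ≡ ⟦ S x ⟧
  pointwise x with S x in Sx
  ... | false = trans (∑ₗ-cong C (λ X → cong ⟦_⟧ (∧-zeroʳ (X x)))) (∑ₗ-zero C)
  ... | true  = trans (∑ₗ-cong C (λ X → cong ⟦_⟧ (∧-identityʳ (X x)))) (petals sf x≢v)
    where
    x≢v : x ≢ v
    x≢v refl = contradiction (trans (sym Sx) Sv) λ ()

petal-sides : Sunflower v (P ∷ Q ∷ []) → S v ≡ false → ∣ P ∩ S ∣ + ∣ Q ∩ S ∣ ≡ ∣ S ∣
petal-sides {P = P} {Q = Q} {S = S} sf Sv =
  trans (cong (∣ P ∩ S ∣ +_) (sym (+-identityʳ ∣ Q ∩ S ∣))) (sunflower-∑ sf Sv)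

∑ₗ-refine : ∀ (σ : Separator n) C (f : VSet n → ℕ) →
  ∑[ Y ∈ refine σ C ] f Y ≡ ∑[ X ∈ C ] (f (X ∩ V₁⁺ σ) + f (X ∩ V₂⁺ σ))
∑ₗ-refine σ []      f = refl
∑ₗ-refine σ (X ∷ C) f = trans (cong (λ r → f (X ∩ V₁⁺ σ) + (f (X ∩ V₂⁺ σ) + r)) (∑ₗ-refine σ C f))
                              (sym (+-assoc (f (X ∩ V₁⁺ σ)) _ _))

refine-sunflower : ∀ (σ : Separator n) → Sunflower (centre σ) C → Sunflower (centre σ) (refine σ C)
refine-sunflower {C = C} σ sf = record
  { core∈  = core (core∈ sf)
  ; petals = λ {x} x≢w →
      trans (∑ₗ-refine σ C (λ Y → ⟦ Y x ⟧)) (trans (∑ₗ-cong C (split x≢w)) (petals sf x≢w))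
  }
  where
  core : ∀ {D} → All (λ X → X (centre σ) ≡ true) D → All (λ X → X (centre σ) ≡ true) (refine σ D)
  core []          = []
  core (Xw ∷ Xws) = cong₂ _∧_ Xw (cong (λ c → not (does (c ≟ 1F))) (label-centre σ))
                  ∷ cong₂ _∧_ Xw (cong (λ c → not (does (c ≟ 0F))) (label-centre σ))
                  ∷ core Xws

  split : ∀ {x} → x ≢ centre σ → ∀ (X : VSet _) →
    ⟦ X x ∧ V₁⁺ σ x ⟧ + ⟦ X x ∧ V₂⁺ σ x ⟧ ≡ ⟦ X x ⟧
  split {x} x≢w X with label σ x in lx | X x
  ... | 0F | true  = refl
  ... | 0F | false = refl
  ... | 1F | true  = refl
  ... | 1F | false = refl
  ... | 2F | _     = contradiction (centre-unique σ lx) x≢w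

petals-meet : Sunflower v (P ∷ Q ∷ []) → P x ≡ true → Q x ≡ true → x ≡ v
petals-meet {v = v} {x = x} sf Px Qx with x ≟ v
... | yes x≡v = x≡v
... | no  x≢v =
  contradiction (trans (sym (petals sf x≢v)) (cong₂ (λ a b → ⟦ a ⟧ + (⟦ b ⟧ + 0)) Px Qx)) λ ()

petals-cover : Sunflower v (P ∷ Q ∷ []) → P x ≡ false → Q x ≡ true
petals-cover {v = v} {Q = Q} {x = x} sf Px with x ≟ v | Q x in Qx
... | _        | true  = refl
... | yes refl | false = contradiction (trans (sym Px) (All.head (core∈ sf))) λ ()
... | no  x≢v  | false =
  contradiction (trans (sym (petals sf x≢v)) (cong₂ (λ a b → ⟦ a ⟧ + (⟦ b ⟧ + 0)) Px Qx)) λ ()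

petals-swap : Sunflower v (P ∷ Q ∷ []) → Sunflower v (Q ∷ P ∷ [])
petals-swap {P = P} {Q = Q} sf = record
  { core∈  = swap-core (core∈ sf)
  ; petals = λ {x} x≢v → trans (sum-swap ⟦ Q x ⟧ ⟦ P x ⟧) (petals sf x≢v)
  }
  where
  swap-core : ∀ {F : VSet _ → Set} → All F (P ∷ Q ∷ []) → All F (Q ∷ P ∷ [])
  swap-core (FP ∷ FQ ∷ []) = FQ ∷ FP ∷ []
  sum-swap : ∀ a b → a + (b + 0) ≡ b + (a + 0)
  sum-swap = solve-∀

capacity-swap : ∀ (P Q : VSet n) → capacity (Q ∷ P ∷ []) ≡ capacity (P ∷ Q ∷ [])
capacity-swap P Q = sum-swap (laman ∣ Q ∣) (laman ∣ P ∣)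
  where
  sum-swap : ∀ a b → a + (b + 0) ≡ b + (a + 0)
  sum-swap = solve-∀

petals-disjoint : Sunflower v (P ∷ Q ∷ []) → S v ≡ false ⊎ Y v ≡ false → Disjoint (P ∩ S) (Q ∩ Y)
petals-disjoint {P = P} {Q = Q} {S = S} {Y = Y} sf v∉ P∩Sx Q∩Yx
  with petals-meet sf (∩-elimˡ {X = P} {Y = S} P∩Sx) (∩-elimˡ {X = Q} {Y = Y} Q∩Yx)
... | refl with v∉
...   | inj₁ Sv = contradiction (trans (sym (∩-elimʳ {X = P} {Y = S} P∩Sx)) Sv) λ ()
...   | inj₂ Yv = contradiction (trans (sym (∩-elimʳ {X = Q} {Y = Y} Q∩Yx)) Yv) λ ()

covers-swap : Covers (P ∷ Q ∷ []) L → Covers (Q ∷ P ∷ []) L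
covers-swap = All.map swap-any
  where
  swap-any : ∀ {e} → Any (λ X → Inside X e) (P ∷ Q ∷ []) → Any (λ X → Inside X e) (Q ∷ P ∷ [])
  swap-any (here e⊆P)         = there (here e⊆P)
  swap-any (there (here e⊆Q)) = here e⊆Q

refine-bounded : ∀ (σ : Separator n) {k} → All (λ X → ∣ X ∣ ≤ k) C →
  All (λ X → ∣ X ∣ ≤ k) (refine σ C)
refine-bounded σ []                   = []
refine-bounded σ (_∷_ {X} ∣X∣≤k rest) = ≤-trans (∣∩∣≤∣∣ˡ {X = X} {Y = V₁⁺ σ}) ∣X∣≤k
                                      ∷ ≤-trans (∣∩∣≤∣∣ˡ {X = X} {Y = V₂⁺ σ}) ∣X∣≤k
                                      ∷ refine-bounded σ rest

capacity₂ : ∀ (X Y : VSet n) {a b} → ∣ X ∣ ≡ a → ∣ Y ∣ ≡ b →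
  capacity (X ∷ Y ∷ []) ≡ laman a + laman b
capacity₂ X Y ∣X∣≡a ∣Y∣≡b =
  cong₂ _+_ (cong laman ∣X∣≡a) (trans (+-identityʳ _) (cong laman ∣Y∣≡b))

capacity₃ : ∀ (X Y Z : VSet n) {a b c} → ∣ X ∣ ≡ a → ∣ Y ∣ ≡ b → ∣ Z ∣ ≡ c →
  capacity (X ∷ Y ∷ Z ∷ []) ≡ laman a + laman b + laman c
capacity₃ X Y Z {a} {b} {c} ∣X∣≡a ∣Y∣≡b ∣Z∣≡c = trans
  (cong₂ _+_ (cong laman ∣X∣≡a) (cong₂ _+_ (cong laman ∣Y∣≡b) (trans (+-identityʳ _) (cong laman ∣Z∣≡c))))
  (sym (+-assoc (laman a) (laman b) (laman c)))

≤-complement : ∀ {a b c k} → a + b ≡ k → c + b ≤ k → c ≤ a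
≤-complement {a} {b} {c} a+b≡k c+b≤k = +-cancelʳ-≤ b c a (≤-trans c+b≤k (≤-reflexive (sym a+b≡k)))

any-pair : ∀ {F : VSet n → Set} → Any F (X ∷ Y ∷ []) → F X ⊎ F Y
any-pair (here FX)         = inj₁ FX
any-pair (there (here FY)) = inj₂ FY

module _ {s : ℕ} (3≤s : 3 ≤ s) where

  private
    2≤s : 2 ≤ s
    2≤s = ≤-trans (n≤1+n 2) 3≤s

    2≤laman[1+s] : 2 ≤ laman (suc s)
    2≤laman[1+s] = ≤-trans (m≤m+n 2 (laman s)) (≤-reflexive (sym (laman-suc 2≤s)))

  disjoint-gainˡ : (st : ErasureStep s s e L) → Disjoint X Y → ∣ X ∣ ≡ s → ∣ Y ∣ ≡ s → Inside X e →
    2 ≤ refinement-gain (separator st) X + refinement-gain (separator st) Y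
  disjoint-gainˡ {e = e} {X = X} {Y = Y} st X∩Y≡∅ ∣X∣≡s ∣Y∣≡s e⊆X = by-centre (X (centre σ)) refl
    where
    σ = separator st
    0<aX = proj₁ (crossing-sides σ {X} e (crosses st) e⊆X)
    0<bX = proj₂ (crossing-sides σ {X} e (crosses st) e⊆X)

    by-centre : ∀ c → X (centre σ) ≡ c → 2 ≤ refinement-gain σ X + refinement-gain σ Y
    by-centre false Xw = begin
      2                                 ≤⟨ gain-cut₂ 0<aX 0<bX (≤-trans 3≤s (≤-reflexive (sym aX+bX≡s))) ⟩
      gain false ∣ X ∩ V₁ σ ∣ ∣ X ∩ V₂ σ ∣ ≡⟨ sym (refinement-gain-at σ X Xw) ⟩
      refinement-gain σ X               ≤⟨ m≤m+n _ _ ⟩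
      refinement-gain σ X + refinement-gain σ Y ∎
      where
      aX+bX≡s = trans (sym (∣∣-by-sides σ X Xw)) ∣X∣≡s
    by-centre true Xw = ≤-trans (n≤1+n 2) (begin
      1 + 2                             ≤⟨ +-mono-≤ (gain-cut true 0<aX 0<bX) (gain-cut₂ 0<aY 0<bY 3≤aY+bY) ⟩
      gain true (∣ X ∩ V₁ σ ∣) (∣ X ∩ V₂ σ ∣) + gain false (∣ Y ∩ V₁ σ ∣) (∣ Y ∩ V₂ σ ∣)
                                        ≡⟨ sym (cong₂ _+_ (refinement-gain-at σ X Xw)
                                                          (refinement-gain-at σ Y Yw)) ⟩
      refinement-gain σ X + refinement-gain σ Y ∎)
      where
      Yw : Y (centre σ) ≡ false
      Yw = ¬-not (X∩Y≡∅ Xw)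
      aY+bY≡s : ∣ Y ∩ V₁ σ ∣ + ∣ Y ∩ V₂ σ ∣ ≡ s
      aY+bY≡s = trans (sym (∣∣-by-sides σ Y Yw)) ∣Y∣≡s
      3≤aY+bY = ≤-trans 3≤s (≤-reflexive (sym aY+bY≡s))
      0<aY : 0 < ∣ Y ∩ V₁ σ ∣
      0<aY = ≤-trans 0<bX (≤-complement aY+bY≡s
        (≤-trans (∣∩∣-disjoint {S = V₂ σ} X∩Y≡∅) (≤-reflexive (∣V₂∣ st))))
      0<bY : 0 < ∣ Y ∩ V₂ σ ∣
      0<bY = ≤-trans 0<aX (≤-complement (trans (+-comm ∣ Y ∩ V₂ σ ∣ ∣ Y ∩ V₁ σ ∣) aY+bY≡s)
        (≤-trans (∣∩∣-disjoint {S = V₁ σ} X∩Y≡∅) (≤-reflexive (∣V₁∣ st))))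

  disjoint-gain : (st : ErasureStep s s e L) → Disjoint X Y → ∣ X ∣ ≡ s → ∣ Y ∣ ≡ s →
    Inside X e ⊎ Inside Y e → 2 ≤ refinement-gain (separator st) X + refinement-gain (separator st) Y
  disjoint-gain st X∩Y≡∅ ∣X∣≡s ∣Y∣≡s (inj₁ e⊆X) = disjoint-gainˡ st X∩Y≡∅ ∣X∣≡s ∣Y∣≡s e⊆X
  disjoint-gain {X = X} {Y = Y} st X∩Y≡∅ ∣X∣≡s ∣Y∣≡s (inj₂ e⊆Y) =
    ≤-trans (disjoint-gainˡ st (λ Yx Xx → X∩Y≡∅ Xx Yx) ∣Y∣≡s ∣X∣≡s e⊆Y)
            (≤-reflexive (+-comm (refinement-gain (separator st) Y) (refinement-gain (separator st) X)))

  disjoint-bound : ErasingOrder s s L → Unique L → Disjoint X Y → ∣ X ∣ ≡ s → ∣ Y ∣ ≡ s →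
    Covers (X ∷ Y ∷ []) L → 1 + length L ≤ capacity (X ∷ Y ∷ [])
  disjoint-bound {L = []} _ _ _ ∣X∣≡s _ _ =
    ≤-trans (laman-pos (≤-trans 2≤s (≤-reflexive (sym ∣X∣≡s)))) (m≤m+n _ _)
  disjoint-bound {L = e ∷ L} {X = X} {Y = Y} (erasable , eo) (e∉L ∷ u) X∩Y≡∅ ∣X∣≡s ∣Y∣≡s (e∈ ∷ cov) =
    refine-bound st eo u cov (≤-trans (disjoint-gain st X∩Y≡∅ ∣X∣≡s ∣Y∣≡s (any-pair e∈))
                                      (+-monoʳ-≤ (refinement-gain σ X) (m≤m+n _ 0)))
    where
    st = erasure-step erasable e∉L
    σ = separator st

  disjoint-pair-bound : ∀ {E} → ErasingOrder s s L → Unique L → Disjoint X Y → ∣ X ∣ ≡ s → ∣ E ∣ ≡ 2 →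
    ∣ Y ∣ ≡ s → Covers (X ∷ E ∷ Y ∷ []) L → 1 + length L ≤ capacity (X ∷ E ∷ Y ∷ [])
  disjoint-pair-bound {L = []} _ _ _ ∣X∣≡s _ _ _ =
    ≤-trans (laman-pos (≤-trans 2≤s (≤-reflexive (sym ∣X∣≡s)))) (m≤m+n _ _)
  disjoint-pair-bound {L = e ∷ L} {X = X} {Y = Y} {E = E}
                      (erasable , eo) (e∉L ∷ u) X∩Y≡∅ ∣X∣≡s ∣E∣≡2 ∣Y∣≡s (e∈ ∷ cov) = by-position e∈
    where
    st = erasure-step erasable e∉L
    σ = separator st

    gain-XY : Inside X e ⊎ Inside Y e → 2 ≤ gains σ (X ∷ E ∷ Y ∷ [])
    gain-XY e⊆X⊎Y = ≤-trans (disjoint-gain st X∩Y≡∅ ∣X∣≡s ∣Y∣≡s e⊆X⊎Y)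
      (+-monoʳ-≤ (refinement-gain σ X) (≤-trans (m≤m+n _ 0) (m≤n+m _ (refinement-gain σ E))))

    by-position : Any (λ Z → Inside Z e) (X ∷ E ∷ Y ∷ []) → 2 + length L ≤ capacity (X ∷ E ∷ Y ∷ [])
    by-position (here e⊆X)                 = refine-bound st eo u cov (gain-XY (inj₁ e⊆X))
    by-position (there (there (here e⊆Y))) = refine-bound st eo u cov (gain-XY (inj₂ e⊆Y))
    by-position (there (here e⊆E))         = begin
      2 + length L                             ≤⟨ s≤s (disjoint-bound eo u X∩Y≡∅ ∣X∣≡s ∣Y∣≡s cov′) ⟩
      1 + capacity (X ∷ Y ∷ [])                ≡⟨ cong suc (capacity₂ X Y refl refl) ⟩
      1 + (laman ∣ X ∣ + laman ∣ Y ∣)          ≡⟨ regroup (laman ∣ X ∣) (laman ∣ Y ∣) ⟩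
      laman ∣ X ∣ + laman 2 + laman ∣ Y ∣      ≡⟨ sym (capacity₃ X E Y refl ∣E∣≡2 refl) ⟩
      capacity (X ∷ E ∷ Y ∷ [])                ∎
      where
      regroup : ∀ x y → 1 + (x + y) ≡ x + 1 + y
      regroup = solve-∀

      -- An edge inside E has the same ends as e, so it would cross σ as well.
      drop-E : ∀ {f} → NonLoop f × ¬ Crosses (label σ) f →
        Any (λ Z → Inside Z f) (X ∷ E ∷ Y ∷ []) → Any (λ Z → Inside Z f) (X ∷ Y ∷ [])
      drop-E _             (here f⊆X)                 = here f⊆X
      drop-E _             (there (there (here f⊆Y))) = there (here f⊆Y)
      drop-E (f↺ , ¬cross) (there (here f⊆E))         = contradiction
        (pair-crossing {E = E} e _ (≤-reflexive ∣E∣≡2) e⊆E f⊆E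
                       (crossing⇒nonloop {p = label σ} e (crosses st)) f↺ (crosses st))
        ¬cross

      cov′ = covers-map (All.zip (erasing-nonloops eo , avoids st)) drop-E cov

  unequal-thin-bound : (st : ErasureStep s s e L) → ErasingOrder s s L → Unique L → Disjoint X Y → ∣ X ∣ ≡ s →
    ∣ Y ∣ ≡ suc s → Y (centre (separator st)) ≡ false → ∣ Y ∩ V₁ (separator st) ∣ ≡ 1 →
    Covers (X ∷ Y ∷ []) L → 3 + length L ≤ capacity (X ∷ Y ∷ [])
  unequal-thin-bound {L = L} {X = X} {Y = Y} st eo u X∩Y≡∅ ∣X∣≡s ∣Y∣≡1+s Yw aY≡1 cov = begin
    3 + length L                        ≤⟨ +-monoʳ-≤ 2 (disjoint-bound eo u X∩Y₂≡∅ ∣X∣≡s ∣Y₂∣≡s cov′) ⟩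
    2 + capacity (X ∷ Y ∩ V₂⁺ σ ∷ [])   ≡⟨ cong (2 +_) (capacity₂ X (Y ∩ V₂⁺ σ) refl ∣Y₂∣≡s) ⟩
    2 + (laman ∣ X ∣ + laman s)         ≡⟨ shift (laman ∣ X ∣) (laman s) ⟩
    laman ∣ X ∣ + (2 + laman s)         ≡⟨ cong (laman ∣ X ∣ +_) (sym (laman-suc 2≤s)) ⟩
    laman ∣ X ∣ + laman (suc s)         ≡⟨ sym (capacity₂ X Y refl ∣Y∣≡1+s) ⟩
    capacity (X ∷ Y ∷ [])               ∎
    where
    σ = separator st
    shift : ∀ a b → 2 + (a + b) ≡ a + (2 + b)
    shift = solve-∀

    ∣Y₁∣≡1 : ∣ Y ∩ V₁⁺ σ ∣ ≡ 1
    ∣Y₁∣≡1 = trans (∣∩V₁⁺∣ σ Y Yw) aY≡1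
    ∣Y₂∣≡s : ∣ Y ∩ V₂⁺ σ ∣ ≡ s
    ∣Y₂∣≡s = trans (∣∩V₂⁺∣ σ Y Yw) (suc-injective (begin-equality
      1 + ∣ Y ∩ V₂ σ ∣                    ≡⟨ cong (_+ ∣ Y ∩ V₂ σ ∣) (sym aY≡1) ⟩
      ∣ Y ∩ V₁ σ ∣ + ∣ Y ∩ V₂ σ ∣         ≡⟨ sym (∣∣-by-sides σ Y Yw) ⟩
      ∣ Y ∣                               ≡⟨ ∣Y∣≡1+s ⟩
      suc s                               ∎))
    X∩Y₂≡∅ : Disjoint X (Y ∩ V₂⁺ σ)
    X∩Y₂≡∅ Xx Y₂x = X∩Y≡∅ Xx (∩-elimˡ {X = Y} {Y = V₂⁺ σ} Y₂x)

    move : ∀ {f} → NonLoop f → Any (λ Z → Inside Z f) (refine σ (X ∷ Y ∷ [])) →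
      Any (λ Z → Inside Z f) (X ∷ Y ∩ V₂⁺ σ ∷ [])
    move _  (here f⊆X₁)                           = here (inside-∩ˡ _ f⊆X₁)
    move _  (there (here f⊆X₂))                   = here (inside-∩ˡ _ f⊆X₂)
    move f↺ (there (there (here f⊆Y₁)))           =
      contradiction f⊆Y₁ (small-no-inside _ (≤-reflexive ∣Y₁∣≡1) f↺)
    move _  (there (there (there (here f⊆Y₂)))) = there (here f⊆Y₂)

    cov′ = covers-map (erasing-nonloops eo) move (refine-covers σ (avoids st) cov)

  unequal-gain : (st : ErasureStep s s e L) → Disjoint X Y → ∣ X ∣ ≡ s → ∣ Y ∣ ≡ suc s →
    Y (centre (separator st)) ≡ true → Inside X e ⊎ Inside Y e → 3 ≤ gains (separator st) (X ∷ Y ∷ [])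
  unequal-gain {e = e} {X = X} {Y = Y} st X∩Y≡∅ ∣X∣≡s ∣Y∣≡1+s Yw e⊆X⊎Y = begin
    3                                     ≤⟨ +-mono-≤ (gain-cut₂ 0<aX 0<bX 3≤aX+bX) (gain-cut true 0<aY 0<bY) ⟩
    gain false aX bX + gain true aY bY    ≡⟨ sym (cong₂ _+_ (refinement-gain-at σ X Xw)
                                                 (trans (+-identityʳ _) (refinement-gain-at σ Y Yw))) ⟩
    gains σ (X ∷ Y ∷ [])                  ∎
    where
    σ = separator st
    aX = ∣ X ∩ V₁ σ ∣
    bX = ∣ X ∩ V₂ σ ∣
    aY = ∣ Y ∩ V₁ σ ∣
    bY = ∣ Y ∩ V₂ σ ∣

    Xw : X (centre σ) ≡ false
    Xw = ¬-not (λ Xw → X∩Y≡∅ Xw Yw)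
    aX+bX≡s : aX + bX ≡ s
    aX+bX≡s = trans (sym (∣∣-by-sides σ X Xw)) ∣X∣≡s
    3≤aX+bX : 3 ≤ aX + bX
    3≤aX+bX = ≤-trans 3≤s (≤-reflexive (sym aX+bX≡s))
    aY+bY≡s : aY + bY ≡ s
    aY+bY≡s = suc-injective (trans (sym (∣∣-by-sides σ Y Yw)) ∣Y∣≡1+s)
    aX+aY≤s : aX + aY ≤ s
    aX+aY≤s = ≤-trans (∣∩∣-disjoint {S = V₁ σ} X∩Y≡∅) (≤-reflexive (∣V₁∣ st))
    bX+bY≤s : bX + bY ≤ s
    bX+bY≤s = ≤-trans (∣∩∣-disjoint {S = V₂ σ} X∩Y≡∅) (≤-reflexive (∣V₂∣ st))

    bX≤aY : bX ≤ aY
    bX≤aY = ≤-complement aY+bY≡s bX+bY≤s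
    aX≤bY : aX ≤ bY
    aX≤bY = ≤-complement (trans (+-comm bY aY) aY+bY≡s) aX+aY≤s
    bY≤aX : bY ≤ aX
    bY≤aX = ≤-complement aX+bX≡s (≤-trans (≤-reflexive (+-comm bY bX)) bX+bY≤s)
    aY≤bX : aY ≤ bX
    aY≤bX = ≤-complement (trans (+-comm bX aX) aX+bX≡s) (≤-trans (≤-reflexive (+-comm aY aX)) aX+aY≤s)

    sides-X : Inside X e ⊎ Inside Y e → 0 < aX × 0 < bX
    sides-X (inj₁ e⊆X) = crossing-sides σ {X} e (crosses st) e⊆X
    sides-X (inj₂ e⊆Y) with crossing-sides σ {Y} e (crosses st) e⊆Y
    ... | 0<aY , 0<bY = ≤-trans 0<bY bY≤aX , ≤-trans 0<aY aY≤bX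

    0<aX = proj₁ (sides-X e⊆X⊎Y)
    0<bX = proj₂ (sides-X e⊆X⊎Y)
    0<aY = ≤-trans 0<bX bX≤aY
    0<bY = ≤-trans 0<aX aX≤bY

  unequal-bound : ErasingOrder s s L → Unique L → Disjoint X Y → ∣ X ∣ ≡ s → ∣ Y ∣ ≡ suc s →
    Covers (X ∷ Y ∷ []) L → 2 + length L ≤ capacity (X ∷ Y ∷ [])
  unequal-bound {L = []} {X = X} _ _ _ _ ∣Y∣≡1+s _ =
    ≤-trans 2≤laman[1+s] (≤-trans (≤-reflexive (cong laman (sym ∣Y∣≡1+s)))
                                  (≤-trans (m≤m+n _ 0) (m≤n+m _ (laman ∣ X ∣))))
  unequal-bound {L = e ∷ L} {X = X} {Y = Y} (erasable , eo) (e∉L ∷ u) X∩Y≡∅ ∣X∣≡s ∣Y∣≡1+s (e∈ ∷ cov) =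
    by-centre (Y (centre σ)) refl
    where
    st = erasure-step erasable e∉L
    σ = separator st

    by-centre : ∀ c → Y (centre σ) ≡ c → 3 + length L ≤ capacity (X ∷ Y ∷ [])
    by-centre true  Yw = refine-bound st eo u cov (unequal-gain st X∩Y≡∅ ∣X∣≡s ∣Y∣≡1+s Yw (any-pair e∈))
    by-centre false Yw = by-sizes ∣ Y ∩ V₁ σ ∣ ∣ Y ∩ V₂ σ ∣ refl refl
      where
      aY+bY≡1+s : ∣ Y ∩ V₁ σ ∣ + ∣ Y ∩ V₂ σ ∣ ≡ suc s
      aY+bY≡1+s = trans (sym (∣∣-by-sides σ Y Yw)) ∣Y∣≡1+s
      0<aY : 0 < ∣ Y ∩ V₁ σ ∣
      0<aY = ≤-complement aY+bY≡1+s (s≤s (≤-trans (∣∩∣≤∣∣ʳ {X = Y}) (≤-reflexive (∣V₂∣ st))))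
      0<bY : 0 < ∣ Y ∩ V₂ σ ∣
      0<bY = ≤-complement (trans (+-comm ∣ Y ∩ V₂ σ ∣ ∣ Y ∩ V₁ σ ∣) aY+bY≡1+s)
                          (s≤s (≤-trans (∣∩∣≤∣∣ʳ {X = Y}) (≤-reflexive (∣V₁∣ st))))

      by-sizes : ∀ a b → ∣ Y ∩ V₁ σ ∣ ≡ a → ∣ Y ∩ V₂ σ ∣ ≡ b →
        3 + length L ≤ capacity (X ∷ Y ∷ [])
      by-sizes 0 _ aY≡0 _ = contradiction (≤-trans 0<aY (≤-reflexive aY≡0)) λ ()
      by-sizes (suc (suc _)) 0 _ bY≡0 = contradiction (≤-trans 0<bY (≤-reflexive bY≡0)) λ ()
      by-sizes 1 _ aY≡1 _ = unequal-thin-bound st eo u X∩Y≡∅ ∣X∣≡s ∣Y∣≡1+s Yw aY≡1 cov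
      by-sizes (suc (suc _)) 1 _ bY≡1 =
        unequal-thin-bound (swap-step st) eo u X∩Y≡∅ ∣X∣≡s ∣Y∣≡1+s Yw (trans (∣∩V₁-swap∣ σ Y) bY≡1) cov
      by-sizes (suc (suc _)) (suc (suc _)) aY≡ bY≡ = refine-bound st eo u cov (begin
        3                                      ≤⟨ gain-cut₃ (≤-trans (s≤s (s≤s z≤n)) (≤-reflexive (sym aY≡)))
                                                            (≤-trans (s≤s (s≤s z≤n)) (≤-reflexive (sym bY≡))) ⟩
        gain false ∣ Y ∩ V₁ σ ∣ ∣ Y ∩ V₂ σ ∣   ≡⟨ sym (refinement-gain-at σ Y Yw) ⟩
        refinement-gain σ Y                    ≤⟨ ≤-trans (m≤m+n _ 0) (m≤n+m _ (refinement-gain σ X)) ⟩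
        gains σ (X ∷ Y ∷ [])                   ∎)

  -- With v on side V₁ every petal X has a vertex in V₁, so its gain is at least
  -- min (∣ X ∩ V₂ ∣, 1) or min (∣ X ∩ V₂ ∣, 2), according as X contains the centre or not.
  sunflower-gain-V₁ : ∀ (σ : Separator n) → Sunflower v C → All (λ X → ∣ X ∣ ≤ s) C →
    centre σ ≢ v → label σ v ≡ 0F → ∣ V₂ σ ∣ ≡ s → 3 ≤ gains σ C
  sunflower-gain-V₁ {v = v} {C = C} σ sf small w≢v v∈V₁ ∣V₂∣≡s = begin
    3                                      ≤⟨ ∑ₗ-capped-≥3 C (λ X → X w) (λ X → ∣ X ∩ V₂ σ ∣) 3≤s
                                                ∑b≡s (petals sf w≢v) (All.zipWith (uncurry bounded) (core∈ sf , small)) ⟩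
    ∑[ X ∈ C ] (∣ X ∩ V₂ σ ∣ ⊓ cap (X w))  ≤⟨ ∑ₗ-mono-≤ (All.map capped (core∈ sf)) ⟩
    gains σ C                              ∎
    where
    w = centre σ

    ∑b≡s : ∑[ X ∈ C ] ∣ X ∩ V₂ σ ∣ ≡ s
    ∑b≡s = trans (sunflower-∑ sf (cong (λ c → does (c ≟ 1F)) v∈V₁)) ∣V₂∣≡s

    0<a : ∀ {X} → X v ≡ true → 0 < ∣ X ∩ V₁ σ ∣
    0<a {X} Xv = 0<∣∣ {X = X ∩ V₁ σ} (cong₂ _∧_ Xv (cong (λ c → does (c ≟ 0F)) v∈V₁))

    capped : ∀ {X} → X v ≡ true → ∣ X ∩ V₂ σ ∣ ⊓ cap (X w) ≤ refinement-gain σ X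
    capped {X} Xv = gain-capped (X w) _ (0<a Xv)

    bounded : ∀ {X} → X v ≡ true → ∣ X ∣ ≤ s → ⟦ X w ⟧ + ∣ X ∩ V₂ σ ∣ < s
    bounded {X} Xv ∣X∣≤s = begin-strict
      ⟦ X w ⟧ + ∣ X ∩ V₂ σ ∣                   <⟨ +-monoʳ-< ⟦ X w ⟧ (+-monoˡ-≤ ∣ X ∩ V₂ σ ∣ (0<a Xv)) ⟩
      ⟦ X w ⟧ + (∣ X ∩ V₁ σ ∣ + ∣ X ∩ V₂ σ ∣)   ≡⟨ sym (∣∣-by-sides σ X refl) ⟩
      ∣ X ∣                                     ≤⟨ ∣X∣≤s ⟩
      s                                         ∎

  sunflower-gain : (st : ErasureStep s s e L) → Sunflower v C → All (λ X → ∣ X ∣ ≤ s) C →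
    centre (separator st) ≢ v → 3 ≤ gains (separator st) C
  sunflower-gain {C = C} st sf small w≢v with side-of (separator st) w≢v
  ... | inj₁ v∈V₁ = sunflower-gain-V₁ (separator st) sf small w≢v v∈V₁ (∣V₂∣ st)
  ... | inj₂ v∈V₂ =
    ≤-trans (sunflower-gain-V₁ (swap (separator st)) sf small w≢v v∈V₂ (∣V₂∣ (swap-step st)))
            (≤-reflexive (gains-swap (separator st) C))

  sunflower-bound : ∀ {L : List (Edge (s + s + 1))} {C v} → ErasingOrder s s L → Unique L →
    Sunflower v C → All (λ X → ∣ X ∣ ≤ s) C → Covers C L → 2 + length L ≤ capacity C
  sunflower-bound {L = []} {C} {v} _ _ sf _ _ = begin
    2                        ≤⟨ ≤-trans 2≤s (m≤m+n s s) ⟩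
    s + s                    ≡⟨ sym ∣V─v∣≡s+s ⟩
    ∣ full ─ v ∣             ≡⟨ sym (sunflower-∑ {S = full ─ v} sf v∉V─v) ⟩
    ∑[ X ∈ C ] ∣ X ─ v ∣     ≤⟨ ∑ₗ-mono-≤ (All.map ∣X─v∣≤laman (core∈ sf)) ⟩
    capacity C               ∎
    where
    v∉V─v : (full ─ v) v ≡ false
    v∉V─v = cong not (dec-true (v ≟ v) refl)
    ∣V─v∣≡s+s : ∣ full ─ v ∣ ≡ s + s
    ∣V─v∣≡s+s = suc-injective (trans (sym (∣∣-remove-∈ {X = full} {x = v} refl)) (trans ∣full∣ (+-comm (s + s) 1)))
    ∣X─v∣≤laman : ∀ {X} → X v ≡ true → ∣ X ─ v ∣ ≤ laman ∣ X ∣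
    ∣X─v∣≤laman {X} Xv = ≤-trans (n≤laman[1+n] _) (≤-reflexive (cong laman (sym (∣∣-remove-∈ {X = X} Xv))))
  sunflower-bound {L = e ∷ L} {C} {v} (erasable , eo) (e∉L ∷ u) sf small (e∈C ∷ cov) =
    by-centre (centre σ ≟ v)
    where
    st = erasure-step erasable e∉L
    σ = separator st

    by-centre : Dec (centre σ ≡ v) → 3 + length L ≤ capacity C
    by-centre (no  w≢v) = refine-bound st eo u cov (sunflower-gain st sf small w≢v)
    by-centre (yes w≡v) = begin
      3 + length L
        ≤⟨ +-mono-≤ (crossing-gain σ e (crosses st) e∈C)
                    (sunflower-bound eo u (refine-sunflower σ sf′) (refine-bounded σ small)
                                     (refine-covers σ (avoids st) cov)) ⟩
      gains σ C + capacity (refine σ C)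
        ≡⟨ sym (capacity-refine σ C) ⟩
      capacity C
        ∎
      where
      sf′ = subst (λ u → Sunflower u C) (sym w≡v) sf

  private
    petal-capacity : ∀ (P Q : VSet n) → ∣ P ∣ ≡ suc s → ∣ Q ∣ ≡ suc s →
      capacity (P ∷ Q ∷ []) ≡ (2 + laman s) + (2 + laman s)
    petal-capacity P Q ∣P∣≡1+s ∣Q∣≡1+s =
      trans (capacity₂ P Q ∣P∣≡1+s ∣Q∣≡1+s) (cong₂ _+_ (laman-suc 2≤s) (laman-suc 2≤s))

  module Centred {e : Edge (s + s + 1)} {L : List (Edge (s + s + 1))} {P Q : VSet (s + s + 1)}
    (st : ErasureStep s s e L) (eo : ErasingOrder s s L) (u : Unique L)
    (sf : Sunflower (centre (separator st)) (P ∷ Q ∷ []))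
    (∣P∣≡1+s : ∣ P ∣ ≡ suc s) (∣Q∣≡1+s : ∣ Q ∣ ≡ suc s) (cov : Covers (P ∷ Q ∷ []) (e ∷ L)) where

    σ = separator st
    aP = ∣ P ∩ V₁ σ ∣
    bP = ∣ P ∩ V₂ σ ∣
    aQ = ∣ Q ∩ V₁ σ ∣
    bQ = ∣ Q ∩ V₂ σ ∣

    Pw : P (centre σ) ≡ true
    Pw = All.head (core∈ sf)
    Qw : Q (centre σ) ≡ true
    Qw = All.head (All.tail (core∈ sf))

    aP+bP≡s : aP + bP ≡ s
    aP+bP≡s = suc-injective (trans (sym (∣∣-by-sides σ P Pw)) ∣P∣≡1+s)

    -- Each side of σ is split between the two petals, so Q mirrors P.
    aQ≡bP : aQ ≡ bP
    aQ≡bP = +-cancelˡ-≡ aP aQ bP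
      (trans (trans (petal-sides sf (cong (λ c → does (c ≟ 0F)) (label-centre σ))) (∣V₁∣ st)) (sym aP+bP≡s))
    bQ≡aP : bQ ≡ aP
    bQ≡aP = +-cancelˡ-≡ bP bQ aP
      (trans (trans (petal-sides sf (cong (λ c → does (c ≟ 1F)) (label-centre σ))) (∣V₂∣ st))
             (trans (sym aP+bP≡s) (+-comm aP bP)))

    sides-P : Any (λ Z → Inside Z e) (P ∷ Q ∷ []) → 0 < aP × 0 < bP
    sides-P (here e⊆P) = crossing-sides σ {P} e (crosses st) e⊆P
    sides-P (there (here e⊆Q)) with crossing-sides σ {Q} e (crosses st) e⊆Q
    ... | 0<aQ , 0<bQ = ≤-trans 0<bQ (≤-reflexive bQ≡aP) , ≤-trans 0<aQ (≤-reflexive aQ≡bP)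

    0<aP = proj₁ (sides-P (All.head cov))
    0<bP = proj₂ (sides-P (All.head cov))

    1+aP≤s : suc aP ≤ s
    1+aP≤s = ≤-trans (+-monoˡ-≤ aP 0<bP) (≤-reflexive (trans (+-comm bP aP) aP+bP≡s))
    1+bP≤s : suc bP ≤ s
    1+bP≤s = ≤-trans (+-monoˡ-≤ bP 0<aP) (≤-reflexive aP+bP≡s)

    pieces≤s : All (λ X → ∣ X ∣ ≤ s) (refine σ (P ∷ Q ∷ []))
    pieces≤s = ≤-trans (≤-reflexive (∣∩V₁⁺∣ σ P Pw)) 1+aP≤s
             ∷ ≤-trans (≤-reflexive (∣∩V₂⁺∣ σ P Pw)) 1+bP≤s
             ∷ ≤-trans (≤-reflexive (trans (∣∩V₁⁺∣ σ Q Qw) (cong suc aQ≡bP))) 1+bP≤s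
             ∷ ≤-trans (≤-reflexive (trans (∣∩V₂⁺∣ σ Q Qw) (cong suc bQ≡aP))) 1+aP≤s
             ∷ []

    2≤gains : 2 ≤ gains σ (P ∷ Q ∷ [])
    2≤gains = begin
      1 + 1                                ≤⟨ +-mono-≤ (gain-cut true 0<aP 0<bP)
                                                (gain-cut true (≤-trans 0<bP (≤-reflexive (sym aQ≡bP)))
                                                               (≤-trans 0<aP (≤-reflexive (sym bQ≡aP)))) ⟩
      gain true aP bP + gain true aQ bQ    ≡⟨ sym (cong₂ _+_ (refinement-gain-at σ P Pw)
                                                (trans (+-identityʳ _) (refinement-gain-at σ Q Qw))) ⟩
      gains σ (P ∷ Q ∷ [])                 ∎

    bound : 4 + length L ≤ capacity (P ∷ Q ∷ [])
    bound = begin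
      2 + (2 + length L)
        ≤⟨ +-mono-≤ 2≤gains (sunflower-bound eo u (refine-sunflower σ sf) pieces≤s
                                             (refine-covers σ (avoids st) (All.tail cov))) ⟩
      gains σ (P ∷ Q ∷ []) + capacity (refine σ (P ∷ Q ∷ []))
        ≡⟨ sym (capacity-refine σ (P ∷ Q ∷ [])) ⟩
      capacity (P ∷ Q ∷ [])
        ∎

  module OffCentre {n} {e : Edge n} {L : List (Edge n)} {v : Fin n} {P Q : VSet n}
    (st : ErasureStep s s e L) (eo : ErasingOrder s s L) (u : Unique L)
    (sf : Sunflower v (P ∷ Q ∷ [])) (∣P∣≡1+s : ∣ P ∣ ≡ suc s) (∣Q∣≡1+s : ∣ Q ∣ ≡ suc s)
    (Pw : P (centre (separator st)) ≡ false) (v∈V₁ : label (separator st) v ≡ 0F)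
    (cov : Covers (P ∷ Q ∷ []) L) where

    σ = separator st
    aP = ∣ P ∩ V₁ σ ∣
    bP = ∣ P ∩ V₂ σ ∣
    aQ = ∣ Q ∩ V₁ σ ∣
    bQ = ∣ Q ∩ V₂ σ ∣

    Qw : Q (centre σ) ≡ true
    Qw = petals-cover sf Pw

    v∉V₂⁺ : V₂⁺ σ v ≡ false
    v∉V₂⁺ = cong (λ c → not (does (c ≟ 0F))) v∈V₁

    bP+bQ≡s : bP + bQ ≡ s
    bP+bQ≡s = trans (petal-sides sf (cong (λ c → does (c ≟ 1F)) v∈V₁)) (∣V₂∣ st)

    aQ≡bP : aQ ≡ bP
    aQ≡bP = +-cancelʳ-≡ bQ aQ bP
      (trans (suc-injective (trans (sym (∣∣-by-sides σ Q Qw)) ∣Q∣≡1+s)) (sym bP+bQ≡s))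

    aP≡1+bQ : aP ≡ suc bQ
    aP≡1+bQ = +-cancelʳ-≡ bP aP (suc bQ)
      (trans (trans (sym (∣∣-by-sides σ P Pw)) ∣P∣≡1+s) (cong suc (trans (sym bP+bQ≡s) (+-comm bP bQ))))

    0<aQ : 0 < aQ
    0<aQ = 0<∣∣ {X = Q ∩ V₁ σ}
      (cong₂ _∧_ (All.head (All.tail (core∈ sf))) (cong (λ c → does (c ≟ 0F)) v∈V₁))

    cov′ : Covers (refine σ (P ∷ Q ∷ [])) L
    cov′ = refine-covers σ (avoids st) cov

    petals≡ : capacity (P ∷ Q ∷ []) ≡ (2 + laman s) + (2 + laman s)
    petals≡ = petal-capacity P Q ∣P∣≡1+s ∣Q∣≡1+s

    pair-case : bP ≡ 1 → 4 + length L ≤ capacity (P ∷ Q ∷ [])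
    pair-case bP≡1 = begin
      3 + (1 + length L)
        ≤⟨ +-monoʳ-≤ 3 (disjoint-pair-bound eo u (petals-disjoint {S = V₁⁺ σ} sf (inj₂ v∉V₂⁺))
                          ∣P₁∣≡s ∣Q₁∣≡2 ∣Q₂∣≡s
                          (drop-small (P ∩ V₁⁺ σ ∷ []) (≤-reflexive ∣P₂∣≡1) (erasing-nonloops eo) cov′)) ⟩
      3 + capacity (P ∩ V₁⁺ σ ∷ Q ∩ V₁⁺ σ ∷ Q ∩ V₂⁺ σ ∷ [])
        ≡⟨ cong (3 +_) (capacity₃ (P ∩ V₁⁺ σ) (Q ∩ V₁⁺ σ) (Q ∩ V₂⁺ σ) ∣P₁∣≡s ∣Q₁∣≡2 ∣Q₂∣≡s) ⟩
      3 + (laman s + 1 + laman s)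
        ≡⟨ regroup (laman s) ⟩
      (2 + laman s) + (2 + laman s)
        ≡⟨ sym petals≡ ⟩
      capacity (P ∷ Q ∷ [])
        ∎
      where
      regroup : ∀ a → 3 + (a + 1 + a) ≡ (2 + a) + (2 + a)
      regroup = solve-∀
      1+bQ≡s = trans (cong (_+ bQ) (sym bP≡1)) bP+bQ≡s
      ∣P₁∣≡s = trans (∣∩V₁⁺∣ σ P Pw) (trans aP≡1+bQ 1+bQ≡s)
      ∣P₂∣≡1 = trans (∣∩V₂⁺∣ σ P Pw) bP≡1
      ∣Q₁∣≡2 = trans (∣∩V₁⁺∣ σ Q Qw) (cong suc (trans aQ≡bP bP≡1))
      ∣Q₂∣≡s = trans (∣∩V₂⁺∣ σ Q Qw) 1+bQ≡s

    unequal-case : bQ ≡ 0 → 4 + length L ≤ capacity (P ∷ Q ∷ [])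
    unequal-case bQ≡0 = begin
      2 + (2 + length L)
        ≤⟨ +-monoʳ-≤ 2 (unequal-bound eo u (petals-disjoint {Y = V₁⁺ σ} sf (inj₁ v∉V₂⁺))
                          ∣P₂∣≡s ∣Q₁∣≡1+s
                          (drop-small (P ∩ V₂⁺ σ ∷ Q ∩ V₁⁺ σ ∷ []) (≤-reflexive ∣Q₂∣≡1) nonloops
                             (drop-small [] (≤-reflexive ∣P₁∣≡1) nonloops cov′))) ⟩
      2 + capacity (P ∩ V₂⁺ σ ∷ Q ∩ V₁⁺ σ ∷ [])
        ≡⟨ cong (2 +_) (capacity₂ (P ∩ V₂⁺ σ) (Q ∩ V₁⁺ σ) ∣P₂∣≡s ∣Q₁∣≡1+s) ⟩
      2 + (laman s + laman (suc s))
        ≡⟨ cong (λ k → 2 + (laman s + k)) (laman-suc 2≤s) ⟩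
      2 + (laman s + (2 + laman s))
        ≡⟨ regroup (laman s) ⟩
      (2 + laman s) + (2 + laman s)
        ≡⟨ sym petals≡ ⟩
      capacity (P ∷ Q ∷ [])
        ∎
      where
      regroup : ∀ a → 2 + (a + (2 + a)) ≡ (2 + a) + (2 + a)
      regroup = solve-∀
      nonloops = erasing-nonloops eo
      bP≡s = trans (sym (+-identityʳ bP)) (trans (cong (bP +_) (sym bQ≡0)) bP+bQ≡s)
      ∣P₁∣≡1 = trans (∣∩V₁⁺∣ σ P Pw) (trans aP≡1+bQ (cong suc bQ≡0))
      ∣P₂∣≡s = trans (∣∩V₂⁺∣ σ P Pw) bP≡s
      ∣Q₁∣≡1+s = trans (∣∩V₁⁺∣ σ Q Qw) (cong suc (trans aQ≡bP bP≡s))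
      ∣Q₂∣≡1 = trans (∣∩V₂⁺∣ σ Q Qw) (cong suc bQ≡0)

    gain-case : 2 ≤ bP → 0 < bQ → 4 + length L ≤ capacity (P ∷ Q ∷ [])
    gain-case 2≤bP 0<bQ = refine-bound st eo u cov (begin
      4                                     ≤⟨ +-mono-≤ (gain-cut₃ 2≤aP 2≤bP) (gain-cut true 0<aQ 0<bQ) ⟩
      gain false aP bP + gain true aQ bQ    ≡⟨ sym (cong₂ _+_ (refinement-gain-at σ P Pw)
                                                 (trans (+-identityʳ _) (refinement-gain-at σ Q Qw))) ⟩
      gains σ (P ∷ Q ∷ [])                  ∎)
      where
      2≤aP = ≤-trans (s≤s 0<bQ) (≤-reflexive (sym aP≡1+bQ))

    bound : 4 + length L ≤ capacity (P ∷ Q ∷ [])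
    bound with bQ in bQ≡ | bP in bP≡
    ... | 0     | _           = unequal-case bQ≡
    ... | suc _ | 0           = contradiction (≤-trans 0<aQ (≤-reflexive (trans aQ≡bP bP≡))) λ ()
    ... | suc _ | 1           = pair-case bP≡
    ... | suc _ | suc (suc _) = gain-case (≤-trans (s≤s (s≤s z≤n)) (≤-reflexive (sym bP≡)))
                                          (≤-trans (s≤s z≤n) (≤-reflexive (sym bQ≡)))

  off-centre-bound : (st : ErasureStep s s e L) → ErasingOrder s s L → Unique L →
    Sunflower v (P ∷ Q ∷ []) → ∣ P ∣ ≡ suc s → ∣ Q ∣ ≡ suc s → P (centre (separator st)) ≡ false →
    centre (separator st) ≢ v → Covers (P ∷ Q ∷ []) L → 4 + length L ≤ capacity (P ∷ Q ∷ [])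
  off-centre-bound st eo u sf ∣P∣≡1+s ∣Q∣≡1+s Pw w≢v cov with side-of (separator st) w≢v
  ... | inj₁ v∈V₁ = OffCentre.bound st eo u sf ∣P∣≡1+s ∣Q∣≡1+s Pw v∈V₁ cov
  ... | inj₂ v∈V₂ = OffCentre.bound (swap-step st) eo u sf ∣P∣≡1+s ∣Q∣≡1+s Pw v∈V₂ cov

  petal-pair-bound : ∀ {L : List (Edge (s + s + 1))} → ErasingOrder s s L → Unique L →
    Sunflower v (P ∷ Q ∷ []) → ∣ P ∣ ≡ suc s → ∣ Q ∣ ≡ suc s → Covers (P ∷ Q ∷ []) L →
    3 + length L ≤ capacity (P ∷ Q ∷ [])
  petal-pair-bound {P = P} {Q = Q} {L = []} _ _ _ ∣P∣≡1+s ∣Q∣≡1+s _ =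
    ≤-trans (s≤s (s≤s (≤-trans (s≤s z≤n) (m≤n+m (2 + laman s) (laman s)))))
            (≤-reflexive (sym (petal-capacity P Q ∣P∣≡1+s ∣Q∣≡1+s)))
  petal-pair-bound {v = v} {P = P} {Q = Q} {L = e ∷ L} (erasable , eo) (e∉L ∷ u) sf ∣P∣≡1+s ∣Q∣≡1+s cov =
    by-centre (centre σ ≟ v)
    where
    st = erasure-step erasable e∉L
    σ = separator st
    w = centre σ

    by-centre : Dec (w ≡ v) → 4 + length L ≤ capacity (P ∷ Q ∷ [])
    by-centre (yes w≡v) =
      Centred.bound st eo u (subst (λ x → Sunflower x (P ∷ Q ∷ [])) (sym w≡v) sf) ∣P∣≡1+s ∣Q∣≡1+s cov
    by-centre (no  w≢v) = by-petal (P w) refl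
      where
      by-petal : ∀ c → P w ≡ c → 4 + length L ≤ capacity (P ∷ Q ∷ [])
      by-petal false Pw = off-centre-bound st eo u sf ∣P∣≡1+s ∣Q∣≡1+s Pw w≢v (All.tail cov)
      by-petal true  Pw = ≤-trans
        (off-centre-bound st eo u (petals-swap sf) ∣Q∣≡1+s ∣P∣≡1+s Qw w≢v (covers-swap (All.tail cov)))
        (≤-reflexive (capacity-swap P Q))
        where
        Qw : Q w ≡ false
        Qw = ¬-not (w≢v ∘ petals-meet sf Pw)

  erasing-bound : ∀ {L : List (Edge (s + s + 1))} → ErasingOrder s s L → Unique L → 4 + length L ≤ 4 * s
  erasing-bound {L = []}    _ _ = *-monoʳ-≤ 4 (≤-trans (s≤s z≤n) 3≤s)
  erasing-bound {L = e ∷ L} (erasable , eo) (e∉L ∷ u) = begin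
    2 + (3 + length L)
      ≤⟨ +-monoʳ-≤ 2 (petal-pair-bound eo u (refine-sunflower σ whole) ∣V₁⁺∣≡1+s ∣V₂⁺∣≡1+s
                                        (refine-covers σ (avoids st) cov)) ⟩
    2 + capacity (refine σ (full ∷ []))
      ≡⟨ cong (2 +_) (petal-capacity (full ∩ V₁⁺ σ) (full ∩ V₂⁺ σ) ∣V₁⁺∣≡1+s ∣V₂⁺∣≡1+s) ⟩
    2 + ((2 + laman s) + (2 + laman s))
      ≡⟨ laman-four 2≤s ⟩
    4 * s
      ∎
    where
    st = erasure-step erasable e∉L
    σ = separator st

    whole : Sunflower (centre σ) (full ∷ [])
    whole = record { core∈ = refl ∷ [] ; petals = λ _ → refl }
    cov : Covers (full ∷ []) L
    cov = All.universal (λ _ → here (refl , refl)) L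
    ∣V₁⁺∣≡1+s : ∣ full ∩ V₁⁺ σ ∣ ≡ suc s
    ∣V₁⁺∣≡1+s = trans (∣∩V₁⁺∣ σ full refl) (cong suc (∣V₁∣ st))
    ∣V₂⁺∣≡1+s : ∣ full ∩ V₂⁺ σ ∣ ≡ suc s
    ∣V₂⁺∣≡1+s = trans (∣∩V₂⁺∣ σ full refl) (cong suc (∣V₂∣ st))

proposition1 : (s : ℕ) → 2 < s → (G : Graph (s + s + 1)) →
    IsErasable s s G → numEdges G ≤ 4 * s ∸ 4
proposition1 s 2<s G (L , L↭E , eo) = begin
  numEdges G   ≡⟨ sym (↭-length L↭E) ⟩
  length L     ≤⟨ m+n≤o⇒m≤o∸n (length L) (≤-trans (≤-reflexive (+-comm (length L) 4)) length-bound) ⟩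
  4 * s ∸ 4    ∎
  where
  L-unique : Unique L
  L-unique = Permutation.Unique-resp-↭ (setoid _) (↭⇒↭ₛ (↭-sym L↭E)) (unique G)
  length-bound : 4 + length L ≤ 4 * s
  length-bound = erasing-bound 2<s eo L-unique
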